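{- Let $G$ be a graph and let $C\subseteq V(G)$ be such that $N(C)=\{n\}$ for a single vertex $n$, where $N(C)=\{v\in V(G)\setminus C : \exists c\in C,\ \{v,c\}\in E(G)\}$. Then $G$ is subhamiltonian if and only if both $G-C$ and $G[C\cup\{n\}]$ are subhamiltonian.
   Context: A (multi-)graph $G$ is subhamiltonian if there is a planar (multi-)graph $G'$ with $V(G')=V(G)$ and $E(G)\subseteq E(G')$ that contains a Hamiltonian cycle. -}

module Defs where

open import Data.Nat using (ℕ; zero; suc; _+_; _*_; _≤ᵇ_)
open import Data.Nat.DivMod using (_mod_)
open import Data.Fin using (Fin; toℕ)
open import Data.Fin.Subset using (Subset; _∈_; _∉_; ∣_∣)
open import Data.Fin.Permutation using (Permutation′; _⟨$⟩ʳ_)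
open import Data.List using (List; allFin; upTo; map)
open import Data.Bool.ListAction using (all)
open import Data.Nat.ListAction using (sum)
open import Data.Bool using (Bool; if_then_else_)
open import Data.Product using (Σ; ∃; ∃-syntax; _×_)
open import Relation.Nullary using (¬_)
open import Relation.Binary.PropositionalEquality using (_≡_; _≢_)

record Graph (N : ℕ) : Set₁ where
  field
    Adj    : Fin N → Fin N → Set
    sym    : ∀ {u v} → Adj u v → Adj v u
    irrefl : ∀ {u} → ¬ Adj u u
open Graph public

InNbhd : ∀ {N} → Graph N → Subset N → Fin N → Set
InNbhd G C v = v ∉ C × ∃[ c ] (c ∈ C × Adj G v c)

iter : ∀ {A : Set} → (A → A) → ℕ → A → A
iter f zero    x = x
iter f (suc k) x = f (iter f k x)

-- Finite multigraphs (loops and parallel edges allowed) with vertex set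
-- S ⊆ Fin N, given together with a combinatorial embedding (rotation
-- system): darts Fin d, each dart has a tail vertex in S, α pairs the two
-- darts of an edge (fixed-point-free involution), σ is a permutation
-- whose cycles are exactly the sets of darts at a vertex (cyclic order
-- of darts around that vertex).

record Map {N : ℕ} (S : Subset N) : Set where
  field
    d       : ℕ
    tail    : Fin d → Fin N
    tail∈S  : ∀ x → tail x ∈ S
    σ       : Permutation′ d
    α       : Permutation′ d
    α-invol : ∀ x → α ⟨$⟩ʳ (α ⟨$⟩ʳ x) ≡ x
    α-free  : ∀ x → α ⟨$⟩ʳ x ≢ x
    σ-tail  : ∀ x → tail (σ ⟨$⟩ʳ x) ≡ tail x
    σ-cycle : ∀ x y → tail x ≡ tail y → ∃[ k ] iter (σ ⟨$⟩ʳ_) k x ≡ y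

  head : Fin d → Fin N
  head x = tail (α ⟨$⟩ʳ x)

  φ : Fin d → Fin d
  φ x = σ ⟨$⟩ʳ (α ⟨$⟩ʳ x)

  numVertices : ℕ
  numVertices = ∣ S ∣

  -- each edge consists of two darts
  numEdges : ℕ
  numEdges = Data.Nat.DivMod._/_ d 2

  -- a dart is the representative of its face iff it has the least index
  -- in its φ-orbit (orbits have size ≤ d)
  isFaceRep : Fin d → Bool
  isFaceRep x = all (λ k → toℕ x ≤ᵇ toℕ (iter φ k x)) (upTo d)

  numFaces : ℕ
  numFaces = sum (map (λ x → if isFaceRep x then 1 else 0) (allFin d))

open Map public

data Reach {N : ℕ} {S : Subset N} (M : Map S) : Fin (d M) → Fin (d M) → Set where
  here  : ∀ {x} → Reach M x x
  stepσ : ∀ {x y} → Reach M (σ M ⟨$⟩ʳ x) y → Reach M x y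
  stepα : ∀ {x y} → Reach M (α M ⟨$⟩ʳ x) y → Reach M x y

Connected : ∀ {N} {S : Subset N} → Map S → Set
Connected M = ∀ x y → Reach M x y

-- A connected combinatorial map is planar (genus 0) iff Euler's formula
-- V − E + F = 2 holds.
PlanarConnected : ∀ {N} {S : Subset N} → Map S → Set
PlanarConnected M = Connected M × (numVertices M + numFaces M ≡ numEdges M + 2)

next : ∀ {k} → Fin k → Fin k
next {suc k} i = suc (toℕ i) mod (suc k)

record HamCycle {N : ℕ} {S : Subset N} (M : Map S) : Set where
  field
    k       : ℕ
    h       : Fin k → Fin N
    h∈S     : ∀ i → h i ∈ S
    h-onto  : ∀ v → v ∈ S → ∃[ i ] h i ≡ v
    h-inj   : ∀ i j → h i ≡ h j → i ≡ j
    e       : Fin k → Fin (d M)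
    e-tail  : ∀ i → tail M (e i) ≡ h i
    e-head  : ∀ i → head M (e i) ≡ h (next i)
    e-dist  : ∀ i j → i ≢ j → (e i ≢ e j) × (e i ≢ α M ⟨$⟩ʳ (e j))

ContainsEdges : ∀ {N} → Graph N → {S : Subset N} → Map S → Set
ContainsEdges {N} G {S} M =
  ∀ (u v : Fin N) → u ∈ S → v ∈ S → Adj G u v →
    ∃[ x ] (tail M x ≡ u × head M x ≡ v)

Subhamiltonian : ∀ {N} → Graph N → Subset N → Set
Subhamiltonian G S =
  Σ (Map S) λ M → PlanarConnected M × ContainsEdges G M × HamCycle M

-- (⇒) If G[S] is subhamiltonian then so is G[S - w]: contract the cycle edge entering w, which keeps
-- the embedding planar and lets the cycle skip w.  Deleting vertices one at a time gives both halves.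
-- (⇐) Glue the two embeddings at n and join the vertex a before n on the first cycle to the vertex b
-- after n on the second by a new edge.  As n separates C from the rest, every edge of G lies in one of
-- the halves, and n → ⋯ → a → b → ⋯ → n is a Hamiltonian cycle.
-- Planarity is tracked through Euler's formula, counting faces as the orbits of the face permutation σα.
module Submission where

open import Defs hiding (sym)
open import Data.Bool using (Bool; true; false; if_then_else_; T)
open import Data.Empty using (⊥-elim)
open import Data.Fin as Fin using (Fin; zero; suc; toℕ; fromℕ<; _↑ˡ_; _↑ʳ_; splitAt; join)
open import Data.Fin.Permutation as Perm
  using (Permutation′; _⟨$⟩ʳ_; _⟨$⟩ˡ_; inverseʳ; inverseˡ; permutation; transpose; _∘ₚ_)
import Data.Fin.Permutation.Components as PC
import Data.Fin.Properties as Finₚ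
open import Data.Fin.Subset using (Subset; _∈_; _∉_; _⊆_; ∣_∣; ⊤; ∁; _∪_; ⁅_⁆; _-_; inside; outside)
open import Data.Fin.Subset.Properties
  using (_∈?_; ∈⊤; x∈∁p⇒x∉p; x∉p⇒x∈∁p; x∈p∪q⁺; x∈p∪q⁻; x∈⁅x⁆; x∈⁅y⁆⇒x≡y; x∈p∧x≢y⇒x∈p-y;
         p─q⊆p; p─⊥≡p; x∈p⇒∣p-x∣<∣p∣; ∪-identityʳ; ∣∁p∣≡n∸∣p∣; ∣p∣≤n; ∣⊤∣≡n; ⊆-antisym)
open import Data.Nat as ℕ using (ℕ; zero; suc; _+_; _*_; _∸_; _≤_; _<_; z≤n; s≤s; _≤ᵇ_)
open import Data.Nat.Properties
open import Data.Product using (∃-syntax; _×_; _,_; proj₁; proj₂)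
open import Data.Sum using (_⊎_; inj₁; inj₂; [_,_]′)
import Data.Sum as Sum
open import Data.Vec using (_∷_; here; there)
open import Function using (_∘_; _⇔_; mk⇔; Equivalence)
open import Function.Bundles using (Injection)
open import Function.Definitions using (Injective)
open import Function.Properties.Inverse using (↔⇒↣)
open import Relation.Binary.Definitions using (tri<; tri≈; tri>)
open import Relation.Binary.PropositionalEquality
open import Relation.Nullary using (¬_; Dec; yes; no)
open import Relation.Nullary.Decidable using (_×-dec_; ¬?; decidable-stable)
open import Algebra.Properties.CommutativeMonoid.Sum +-0-commutativeMonoid
  using (sum-permute; sum-cong-≗; ∑-distrib-+) renaming (sum to ∑)
open import Data.Bool.ListAction using (all; and)
open import Data.List using (map; upTo; allFin; tabulate)
import Data.List.Properties as Listₚ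
open import Data.List.Relation.Unary.All as All using (All)
open import Data.List.Relation.Unary.All.Properties using (all⁺; all⁻)
open import Data.List.Membership.Propositional.Properties using (∈-upTo⁺)
import Data.Nat.ListAction as List
open import Data.Nat.DivMod using (_%_; _/_; m<n⇒m%n≡m; n%n≡0; m*n/n≡m; m%n<n; m≡m%n+[m/n]*n)
open import Data.Nat.Solver using (module +-*-Solver)

perm-injective : ∀ {d} (π : Permutation′ d) → Injective _≡_ _≡_ (π ⟨$⟩ʳ_)
perm-injective π = Injection.injective (↔⇒↣ π)

-- Orbits

module _ {A : Set} (f : A → A) where

  iter-suc : ∀ k x → iter f k (f x) ≡ f (iter f k x)
  iter-suc zero    x = refl
  iter-suc (suc k) x = cong f (iter-suc k x)

  iter-+ : ∀ m n x → iter f (m + n) x ≡ iter f m (iter f n x)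
  iter-+ zero    n x = refl
  iter-+ (suc m) n x = cong f (iter-+ m n x)

  iter-comm : ∀ m n x → iter f m (iter f n x) ≡ iter f n (iter f m x)
  iter-comm m n x = trans (sym (iter-+ m n x)) (trans (cong (λ k → iter f k x) (+-comm m n)) (iter-+ n m x))

  iter-injective : Injective _≡_ _≡_ f → ∀ k {x y} → iter f k x ≡ iter f k y → x ≡ y
  iter-injective f-inj zero    eq = eq
  iter-injective f-inj (suc k) eq = iter-injective f-inj k (f-inj eq)

  iter-*-periodic : ∀ {L x} → iter f L x ≡ x → ∀ m → iter f (m * L) x ≡ x
  iter-*-periodic         eq zero    = refl
  iter-*-periodic {L} {x} eq (suc m) = begin
    iter f (L + m * L) x          ≡⟨ iter-+ L (m * L) x ⟩
    iter f L (iter f (m * L) x)   ≡⟨ cong (iter f L) (iter-*-periodic eq m) ⟩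
    iter f L x                    ≡⟨ eq ⟩
    x                             ∎
    where open ≡-Reasoning

  iter-fixed : ∀ {x} → f x ≡ x → ∀ k → iter f k x ≡ x
  iter-fixed fx zero    = refl
  iter-fixed fx (suc k) = trans (cong f (iter-fixed fx k)) fx

iter-cong : ∀ {A : Set} {f g : A → A} → (∀ z → f z ≡ g z) → ∀ k x → iter f k x ≡ iter g k x
iter-cong     f≗g zero    x = refl
iter-cong {g = g} f≗g (suc k) x = trans (f≗g _) (cong g (iter-cong f≗g k x))

iter-agree : ∀ {A : Set} (f g : A → A) (B : A → Set) → (∀ z → ¬ B z → g z ≡ f z) →
  ∀ k x → (∀ j → j < k → ¬ B (iter f j x)) → iter g k x ≡ iter f k x
iter-agree f g B agree zero    x avoid = refl
iter-agree f g B agree (suc k) x avoid =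
  trans (cong g (iter-agree f g B agree k x (λ j j<k → avoid j (m<n⇒m<1+n j<k))))
        (agree _ (avoid k ≤-refl))

infix 4 _↝⟨_⟩_

_↝⟨_⟩_ : ∀ {A : Set} → A → (A → A) → A → Set
x ↝⟨ f ⟩ y = ∃[ k ] iter f k x ≡ y

module _ {A : Set} {f : A → A} where

  ↝-refl : ∀ {x} → x ↝⟨ f ⟩ x
  ↝-refl = 0 , refl

  ↝-step : ∀ {x} → x ↝⟨ f ⟩ f x
  ↝-step = 1 , refl

  ↝-trans : ∀ {x y z} → x ↝⟨ f ⟩ y → y ↝⟨ f ⟩ z → x ↝⟨ f ⟩ z
  ↝-trans {x} (k , refl) (l , refl) = l + k , iter-+ f l k x

  ↝-fixed : ∀ {x y} → f x ≡ x → x ↝⟨ f ⟩ y → x ≡ y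
  ↝-fixed fx (k , refl) = sym (iter-fixed f fx k)

↝-cong : ∀ {A : Set} {f g : A → A} → (∀ z → f z ≡ g z) → ∀ {x y} → x ↝⟨ f ⟩ y → x ↝⟨ g ⟩ y
↝-cong f≗g {x} (k , refl) = k , sym (iter-cong f≗g k x)

least-witness : (P : ℕ → Set) → (∀ n → Dec (P n)) → ∀ {k} → P k →
  ∃[ m ] P m × (∀ j → j < m → ¬ P j)
least-witness P P? {k} pk = search k 0 (λ _ ()) (subst P (sym (+-identityʳ k)) pk)
  where
  search : ∀ fuel n → (∀ j → j < n → ¬ P j) → P (fuel + n) → ∃[ m ] P m × (∀ j → j < m → ¬ P j)
  search zero       n below p = n , p , below
  search (suc fuel) n below p with P? n
  ... | yes pn = n , pn , below
  ... | no ¬pn = search fuel (suc n) below′ (subst P (sym (+-suc fuel n)) p)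
    where
    below′ : ∀ j → j < suc n → ¬ P j
    below′ j j<1+n with m≤n⇒m<n∨m≡n (≤-pred j<1+n)
    ... | inj₁ j<n  = below j j<n
    ... | inj₂ refl = ¬pn

shortest-path : ∀ {d} (f : Fin d → Fin d) {x y} → x ↝⟨ f ⟩ y →
  ∃[ k ] iter f k x ≡ y × (∀ j → j < k → iter f j x ≢ y)
shortest-path f {x} {y} (k , eq) = least-witness (λ k → iter f k x ≡ y) (λ k → iter f k x Finₚ.≟ y) {k} eq

module _ {d} {f : Fin d → Fin d} (f-inj : Injective _≡_ _≡_ f) where

  ∃-period : ∀ x → ∃[ L ] 0 < L × L ≤ d × iter f L x ≡ x
  ∃-period x with Finₚ.pigeonhole (n<1+n d) (λ (i : Fin (suc d)) → iter f (toℕ i) x)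
  ... | i , j , i<j , eq =
    toℕ j ∸ toℕ i , m<n⇒0<n∸m i<j , ≤-trans (m∸n≤m (toℕ j) (toℕ i)) (≤-pred (Finₚ.toℕ<n j)) ,
    iter-injective f f-inj (toℕ i) (begin
      iter f (toℕ i) (iter f (toℕ j ∸ toℕ i) x) ≡⟨ iter-+ f (toℕ i) (toℕ j ∸ toℕ i) x ⟨
      iter f (toℕ i + (toℕ j ∸ toℕ i)) x         ≡⟨ cong (λ m → iter f m x) (m+[n∸m]≡n (<⇒≤ i<j)) ⟩
      iter f (toℕ j) x                          ≡⟨ eq ⟨
      iter f (toℕ i) x                          ∎)
    where open ≡-Reasoning

  -- k·L − k further steps complete k full periods.
  ↝-sym : ∀ {x y} → x ↝⟨ f ⟩ y → y ↝⟨ f ⟩ x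
  ↝-sym {x} (k , refl) with ∃-period x
  ... | L , 0<L , _ , period = k * L ∸ k , (begin
    iter f (k * L ∸ k) (iter f k x) ≡⟨ iter-+ f (k * L ∸ k) k x ⟨
    iter f (k * L ∸ k + k) x        ≡⟨ cong (λ m → iter f m x) (m∸n+n≡m (m≤m*n k L {{ℕ.>-nonZero 0<L}})) ⟩
    iter f (k * L) x                ≡⟨ iter-*-periodic f period k ⟩
    x                               ∎)
    where open ≡-Reasoning

  ↝-bounded : ∀ {x y} → x ↝⟨ f ⟩ y → ∃[ k ] k < d × iter f k x ≡ y
  ↝-bounded {x} {y} (k , eq) with ∃-period x
  ... | L , 0<L , L≤d , period = k % L , ≤-trans (m%n<n k L) L≤d , (begin
    iter f (k % L) x                        ≡⟨ cong (iter f (k % L)) (iter-*-periodic f period (k / L)) ⟨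
    iter f (k % L) (iter f (k / L * L) x)   ≡⟨ iter-+ f (k % L) (k / L * L) x ⟨
    iter f (k % L + k / L * L) x            ≡⟨ cong (λ m → iter f m x) (m≡m%n+[m/n]*n k L) ⟨
    iter f k x                              ≡⟨ eq ⟩
    y                                       ∎)
    where
    open ≡-Reasoning
    instance
      L≢0 : ℕ.NonZero L
      L≢0 = ℕ.>-nonZero 0<L

  ↝-dec : ∀ x y → Dec (x ↝⟨ f ⟩ y)
  ↝-dec x y with Finₚ.any? (λ (i : Fin d) → iter f (toℕ i) x Finₚ.≟ y)
  ... | yes (i , eq) = yes (toℕ i , eq)
  ... | no ¬hit = no λ x↝y → let (k , k<d , eq) = ↝-bounded x↝y in
    ¬hit (fromℕ< k<d , trans (cong (λ m → iter f m x) (Finₚ.toℕ-fromℕ< k<d)) eq)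

-- Counting orbits

∑-tabulate : ∀ {d} (a : Fin d → ℕ) → List.sum (tabulate a) ≡ ∑ a
∑-tabulate {zero}  a = refl
∑-tabulate {suc d} a = cong (a zero +_) (∑-tabulate (a ∘ suc))

∑-suc-at : ∀ {d} (a b : Fin d → ℕ) (m : Fin d) →
  (∀ x → x ≢ m → a x ≡ b x) → a m ≡ suc (b m) → ∑ a ≡ suc (∑ b)
∑-suc-at a b zero    same bump =
  cong₂ _+_ bump (sum-cong-≗ (λ x → same (suc x) λ ()))
∑-suc-at a b (suc m) same bump =
  trans (cong₂ _+_ (same zero λ ()) (∑-suc-at (a ∘ suc) (b ∘ suc) m same-suc bump)) (+-suc _ _)
  where
  same-suc : ∀ x → x ≢ m → a (suc x) ≡ b (suc x)
  same-suc x x≢m = same (suc x) (x≢m ∘ Finₚ.suc-injective)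

∑-↑ : ∀ m {n} (a : Fin (m + n) → ℕ) → ∑ a ≡ ∑ (λ x → a (x ↑ˡ n)) + ∑ (λ y → a (m ↑ʳ y))
∑-↑ zero    a = refl
∑-↑ (suc m) a = trans (cong (a zero +_) (∑-↑ m (a ∘ suc))) (sym (+-assoc (a zero) _ _))

module _ {d} (f : Fin d → Fin d) where

  OrbitMin : Fin d → Set
  OrbitMin x = ∀ y → x ↝⟨ f ⟩ y → toℕ x ≤ toℕ y

  -- Same test as Map.isFaceRep, so that numFaces M is orbitCount (φ M) by definition.
  orbitMinᵇ : Fin d → Bool
  orbitMinᵇ x = all (λ k → toℕ x ≤ᵇ toℕ (iter f k x)) (upTo d)

  orbitIndicator : Fin d → ℕ
  orbitIndicator x = if orbitMinᵇ x then 1 else 0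

  orbitCount : ℕ
  orbitCount = List.sum (map orbitIndicator (allFin d))

  orbitCount≡∑ : orbitCount ≡ ∑ orbitIndicator
  orbitCount≡∑ = trans (cong List.sum (Listₚ.map-tabulate (λ x → x) orbitIndicator)) (∑-tabulate orbitIndicator)

module _ {d} {f : Fin d → Fin d} (f-inj : Injective _≡_ _≡_ f) where

  orbitMinᵇ⇔ : ∀ x → T (orbitMinᵇ f x) ⇔ OrbitMin f x
  orbitMinᵇ⇔ x = mk⇔ to from
    where
    to : T (orbitMinᵇ f x) → OrbitMin f x
    to t y x↝y with ↝-bounded f-inj x↝y
    ... | k , k<d , refl = ≤ᵇ⇒≤ (toℕ x) _ (All.lookup (all⁺ _ (upTo d) t) (∈-upTo⁺ k<d))
    from : OrbitMin f x → T (orbitMinᵇ f x)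
    from min = all⁻ _ {upTo d} (All.tabulate λ {k} _ → ≤⇒≤ᵇ (min _ (k , refl)))

  orbitIndicator-min : ∀ {x} → OrbitMin f x → orbitIndicator f x ≡ 1
  orbitIndicator-min {x} min with orbitMinᵇ f x | Equivalence.from (orbitMinᵇ⇔ x) min
  ... | true | _ = refl

  orbitIndicator-¬min : ∀ {x} → ¬ OrbitMin f x → orbitIndicator f x ≡ 0
  orbitIndicator-¬min {x} ¬min with orbitMinᵇ f x in eq
  ... | true  = ⊥-elim (¬min (Equivalence.to (orbitMinᵇ⇔ x) (subst T (sym eq) _)))
  ... | false = refl

  orbitMin-unique : ∀ {a b} → OrbitMin f a → OrbitMin f b → a ↝⟨ f ⟩ b → a ≡ b
  orbitMin-unique min-a min-b a↝b = Finₚ.toℕ-injective (≤-antisym (min-a _ a↝b) (min-b _ (↝-sym f-inj a↝b)))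

  ∃-orbitMin : ∀ x → ∃[ m ] x ↝⟨ f ⟩ m × OrbitMin f m
  ∃-orbitMin x with least-witness HasIndex hasIndex? (x , ↝-refl , refl)
    where
    HasIndex : ℕ → Set
    HasIndex i = ∃[ y ] x ↝⟨ f ⟩ y × toℕ y ≡ i
    hasIndex? : ∀ i → Dec (HasIndex i)
    hasIndex? i = Finₚ.any? (λ y → ↝-dec f-inj x y ×-dec (toℕ y ℕ.≟ i))
  ... | _ , (m , x↝m , refl) , smaller = m , x↝m , λ y m↝y →
    ≮⇒≥ λ y<m → smaller (toℕ y) y<m (y , ↝-trans x↝m m↝y , refl)

orbitIndicator-cong : ∀ {d d′} {f : Fin d → Fin d} {g : Fin d′ → Fin d′} →
  Injective _≡_ _≡_ f → Injective _≡_ _≡_ g →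
  ∀ {x y} → OrbitMin f x ⇔ OrbitMin g y → orbitIndicator f x ≡ orbitIndicator g y
orbitIndicator-cong {f = f} {g} f-inj g-inj {x} {y} min⇔ with orbitMinᵇ f x in p | orbitMinᵇ g y in q
... | true  | true  = refl
... | false | false = refl
... | true  | false = ⊥-elim (subst T q (Equivalence.from (orbitMinᵇ⇔ g-inj y)
                        (Equivalence.to min⇔ (Equivalence.to (orbitMinᵇ⇔ f-inj x) (subst T (sym p) _)))))
... | false | true  = ⊥-elim (subst T p (Equivalence.from (orbitMinᵇ⇔ f-inj x)
                        (Equivalence.from min⇔ (Equivalence.to (orbitMinᵇ⇔ g-inj y) (subst T (sym q) _)))))

orbitCount-cong : ∀ {d} {f g : Fin d → Fin d} → (∀ z → f z ≡ g z) → orbitCount f ≡ orbitCount g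
orbitCount-cong {d} {f} {g} f≗g = cong List.sum (Listₚ.map-cong same-indicator (allFin d))
  where
  same-indicator : ∀ x → orbitIndicator f x ≡ orbitIndicator g x
  same-indicator x = cong (λ b → if b then 1 else 0)
    (cong and (Listₚ.map-cong (λ k → cong (λ y → toℕ x ≤ᵇ toℕ y) (iter-cong f≗g k x)) (upTo d)))

-- Composing with a transposition

record Transposed {d} (f g : Fin d → Fin d) (p q : Fin d) : Set where
  field
    p≢q       : p ≢ q
    at-p      : g p ≡ f q
    at-q      : g q ≡ f p
    elsewhere : ∀ z → z ≢ p → z ≢ q → g z ≡ f z

module _ {d} {p q : Fin d} where

  transpose-at-p : PC.transpose p q p ≡ q
  transpose-at-p with p Finₚ.≟ p
  ... | yes _  = refl
  ... | no p≢p = ⊥-elim (p≢p refl)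

  transpose-at-q : PC.transpose p q q ≡ p
  transpose-at-q with q Finₚ.≟ p
  ... | yes q≡p = q≡p
  ... | no _ with q Finₚ.≟ q
  ...   | yes _  = refl
  ...   | no q≢q = ⊥-elim (q≢q refl)

  transpose-elsewhere : ∀ {z} → z ≢ p → z ≢ q → PC.transpose p q z ≡ z
  transpose-elsewhere {z} z≢p z≢q with z Finₚ.≟ p
  ... | yes z≡p = ⊥-elim (z≢p z≡p)
  ... | no _ with z Finₚ.≟ q
  ...   | yes z≡q = ⊥-elim (z≢q z≡q)
  ...   | no _    = refl

  transposed : (f : Fin d → Fin d) → p ≢ q → Transposed f (f ∘ PC.transpose p q) p q
  transposed f p≢q = record
    { p≢q = p≢q ; at-p = cong f transpose-at-p ; at-q = cong f transpose-at-q
    ; elsewhere = λ _ z≢p z≢q → cong f (transpose-elsewhere z≢p z≢q) }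

  transpose-preserves : ∀ {A : Set} (h : Fin d → A) → h p ≡ h q → ∀ z → h (PC.transpose p q z) ≡ h z
  transpose-preserves h hp≡hq z = cases (z Finₚ.≟ p) (z Finₚ.≟ q)
    where
    cases : Dec (z ≡ p) → Dec (z ≡ q) → h (PC.transpose p q z) ≡ h z
    cases (yes z≡p) _ =
      trans (cong (h ∘ PC.transpose p q) z≡p) (trans (cong h transpose-at-p) (trans (sym hp≡hq) (cong h (sym z≡p))))
    cases (no _) (yes z≡q) =
      trans (cong (h ∘ PC.transpose p q) z≡q) (trans (cong h transpose-at-q) (trans hp≡hq (cong h (sym z≡q))))
    cases (no z≢p) (no z≢q) = cong h (transpose-elsewhere z≢p z≢q)

module _ {d} {f g : Fin d → Fin d} {p q : Fin d} (tr : Transposed f g p q) where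
  open Transposed tr

  transposed-flip : Transposed g f p q
  transposed-flip = record
    { p≢q = p≢q ; at-p = sym at-q ; at-q = sym at-p ; elsewhere = λ z a b → sym (elsewhere z a b) }

  transposed-∘ : (α : Fin d → Fin d) → (∀ z → α (α z) ≡ z) → Transposed (f ∘ α) (g ∘ α) (α p) (α q)
  transposed-∘ α invol = record
    { p≢q = λ eq → p≢q (α-injective eq)
    ; at-p = trans (cong g (invol p)) (trans at-p (cong f (sym (invol q))))
    ; at-q = trans (cong g (invol q)) (trans at-q (cong f (sym (invol p))))
    ; elsewhere = λ z z≢αp z≢αq → elsewhere (α z) (λ eq → z≢αp (moved eq)) (λ eq → z≢αq (moved eq)) }
    where
    α-injective : Injective _≡_ _≡_ α
    α-injective {x} {y} eq = trans (sym (invol x)) (trans (cong α eq) (invol y))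
    moved : ∀ {z w} → α z ≡ w → z ≡ α w
    moved {z} eq = trans (sym (invol z)) (cong α eq)

module Merge {d} {f g : Fin d → Fin d} (f-inj : Injective _≡_ _≡_ f) (g-inj : Injective _≡_ _≡_ g)
             {p q : Fin d} (tr : Transposed f g p q) (p≁q : ¬ p ↝⟨ f ⟩ q) where
  open Transposed tr

  agree-avoiding : ∀ k x → (∀ j → j < k → iter f j x ≢ p × iter f j x ≢ q) → iter g k x ≡ iter f k x
  agree-avoiding k x avoid =
    iter-agree f g (λ z → z ≡ p ⊎ z ≡ q) (λ z z∉ → elsewhere z (z∉ ∘ inj₁) (z∉ ∘ inj₂)) k x
      (λ j j<k → [ proj₁ (avoid j j<k) , proj₂ (avoid j j<k) ]′)

  -- The f-cycle through a, minus a, is still a g-path from f a back to a.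
  return-path : ∀ {a} → (∀ {z} → a ↝⟨ f ⟩ z → z ≢ a → z ≢ p × z ≢ q) → f a ↝⟨ g ⟩ a
  return-path {a} off-pq with shortest-path f (↝-sym f-inj (↝-step {f = f} {a}))
  ... | k , eq , shortest =
    k , trans (agree-avoiding k (f a) (λ j j<k → off-pq (↝-trans ↝-step (j , refl)) (shortest j j<k))) eq

  off-pq-from-p : ∀ {z} → p ↝⟨ f ⟩ z → z ≢ p → z ≢ p × z ≢ q
  off-pq-from-p p↝z z≢p = z≢p , λ z≡q → p≁q (subst (p ↝⟨ f ⟩_) z≡q p↝z)

  off-pq-from-q : ∀ {z} → q ↝⟨ f ⟩ z → z ≢ q → z ≢ p × z ≢ q
  off-pq-from-q q↝z z≢q = (λ z≡p → p≁q (↝-sym f-inj (subst (q ↝⟨ f ⟩_) z≡p q↝z))) , z≢q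

  p↝q : p ↝⟨ g ⟩ q
  p↝q = ↝-trans (subst (p ↝⟨ g ⟩_) at-p ↝-step) (return-path off-pq-from-q)

  step-preserved : ∀ z → z ↝⟨ g ⟩ f z
  step-preserved z with z Finₚ.≟ p | z Finₚ.≟ q
  ... | yes refl | _ = ↝-trans p↝q (subst (q ↝⟨ g ⟩_) at-q ↝-step)
  ... | no _ | yes refl =
    ↝-trans (↝-trans (subst (q ↝⟨ g ⟩_) at-q ↝-step) (return-path off-pq-from-p))
            (subst (p ↝⟨ g ⟩_) at-p ↝-step)
  ... | no z≢p | no z≢q = subst (z ↝⟨ g ⟩_) (elsewhere z z≢p z≢q) ↝-step

  ↝-preserved : ∀ {x y} → x ↝⟨ f ⟩ y → x ↝⟨ g ⟩ y
  ↝-preserved {x} (zero  , refl) = ↝-refl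
  ↝-preserved {x} (suc k , refl) = ↝-trans (↝-preserved (k , refl)) (step-preserved _)

  OnMerged : Fin d → Set
  OnMerged z = p ↝⟨ f ⟩ z ⊎ q ↝⟨ f ⟩ z

  onMerged-step : ∀ {z} → OnMerged z → OnMerged (g z)
  onMerged-step {z} on with z Finₚ.≟ p | z Finₚ.≟ q
  ... | yes refl | _        = subst OnMerged (sym at-p) (inj₂ ↝-step)
  ... | no _     | yes refl = subst OnMerged (sym at-q) (inj₁ ↝-step)
  ... | no z≢p   | no z≢q   =
    subst OnMerged (sym (elsewhere z z≢p z≢q)) (Sum.map (λ r → ↝-trans r ↝-step) (λ r → ↝-trans r ↝-step) on)

  onMerged-closed : ∀ {x y} → OnMerged x → x ↝⟨ g ⟩ y → OnMerged y
  onMerged-closed on (zero  , refl) = on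
  onMerged-closed on (suc k , refl) = onMerged-step (onMerged-closed on (k , refl))

  onMerged-connected : ∀ {x y} → OnMerged x → OnMerged y → x ↝⟨ g ⟩ y
  onMerged-connected on-x on-y = ↝-trans (to-p on-x) (↝-sym g-inj (to-p on-y))
    where
    to-p : ∀ {z} → OnMerged z → z ↝⟨ g ⟩ p
    to-p (inj₁ p↝z) = ↝-preserved (↝-sym f-inj p↝z)
    to-p (inj₂ q↝z) = ↝-trans (↝-preserved (↝-sym f-inj q↝z)) (↝-sym g-inj p↝q)

  ↝-reflected : ∀ {x y} → ¬ OnMerged x → x ↝⟨ g ⟩ y → x ↝⟨ f ⟩ y
  ↝-reflected {x} off (k , eq) = k , trans (sym (agree-avoiding k x avoid)) eq
    where
    avoid : ∀ j → j < k → iter f j x ≢ p × iter f j x ≢ q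
    avoid j _ = (λ eq → off (inj₁ (↝-sym f-inj (j , eq)))) , (λ eq → off (inj₂ (↝-sym f-inj (j , eq))))

  -- The minimum of the merged cycle is the smaller of the two old minima; only the larger one is lost.
  private
    module Count {lo hi : Fin d} (min-lo : OrbitMin f lo) (min-hi : OrbitMin f hi) (lo<hi : toℕ lo < toℕ hi)
                 (merged⇒ : ∀ {y} → OnMerged y → lo ↝⟨ f ⟩ y ⊎ hi ↝⟨ f ⟩ y)
                 (on-lo : OnMerged lo) (on-hi : OnMerged hi) where

      hi-not-min : ¬ OrbitMin g hi
      hi-not-min min = <⇒≱ lo<hi (min lo (onMerged-connected on-hi on-lo))

      min-preserved-on : ∀ {x} → x ≢ hi → OrbitMin f x → OnMerged x → OrbitMin g x
      min-preserved-on x≢hi min-x on-x with merged⇒ on-x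
      ... | inj₂ hi↝x = ⊥-elim (x≢hi (sym (orbitMin-unique f-inj min-hi min-x hi↝x)))
      ... | inj₁ lo↝x with orbitMin-unique f-inj min-lo min-x lo↝x
      ...   | refl = λ y lo↝y → [ min-lo y , (λ hi↝y → <⇒≤ (<-≤-trans lo<hi (min-hi y hi↝y))) ]′
                                  (merged⇒ (onMerged-closed on-lo lo↝y))

      min-preserved : ∀ {x} → x ≢ hi → OrbitMin f x → OrbitMin g x
      min-preserved {x} x≢hi min-x with ↝-dec f-inj p x | ↝-dec f-inj q x
      ... | yes p↝x | _       = min-preserved-on x≢hi min-x (inj₁ p↝x)
      ... | no _    | yes q↝x = min-preserved-on x≢hi min-x (inj₂ q↝x)
      ... | no p≁x  | no q≁x  = λ y x↝y → min-x y (↝-reflected [ p≁x , q≁x ]′ x↝y)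

      min-reflected : ∀ {x} → OrbitMin g x → OrbitMin f x
      min-reflected min y x↝y = min y (↝-preserved x↝y)

      result : orbitCount f ≡ suc (orbitCount g)
      result = begin
        orbitCount f                  ≡⟨ orbitCount≡∑ f ⟩
        ∑ (orbitIndicator f)          ≡⟨ ∑-suc-at (orbitIndicator f) (orbitIndicator g) hi same bump ⟩
        suc (∑ (orbitIndicator g))    ≡⟨ cong suc (orbitCount≡∑ g) ⟨
        suc (orbitCount g)            ∎
        where
        open ≡-Reasoning
        same : ∀ x → x ≢ hi → orbitIndicator f x ≡ orbitIndicator g x
        same x x≢hi = orbitIndicator-cong f-inj g-inj (mk⇔ (min-preserved x≢hi) min-reflected)
        bump : orbitIndicator f hi ≡ suc (orbitIndicator g hi)
        bump = trans (orbitIndicator-min f-inj min-hi) (cong suc (sym (orbitIndicator-¬min g-inj hi-not-min)))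

  orbitCount-merge : orbitCount f ≡ suc (orbitCount g)
  orbitCount-merge with ∃-orbitMin f-inj p | ∃-orbitMin f-inj q
  ... | mp , p↝mp , min-mp | mq , q↝mq , min-mq with <-cmp (toℕ mp) (toℕ mq)
  ... | tri< mp<mq _ _ = Count.result min-mp min-mq mp<mq merged⇒ (inj₁ p↝mp) (inj₂ q↝mq)
    where
    merged⇒ : ∀ {y} → OnMerged y → mp ↝⟨ f ⟩ y ⊎ mq ↝⟨ f ⟩ y
    merged⇒ = Sum.map (↝-trans (↝-sym f-inj p↝mp)) (↝-trans (↝-sym f-inj q↝mq))
  ... | tri> _ _ mq<mp = Count.result min-mq min-mp mq<mp merged⇒ (inj₂ q↝mq) (inj₁ p↝mp)
    where
    merged⇒ : ∀ {y} → OnMerged y → mq ↝⟨ f ⟩ y ⊎ mp ↝⟨ f ⟩ y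
    merged⇒ = Sum.swap ∘ Sum.map (↝-trans (↝-sym f-inj p↝mp)) (↝-trans (↝-sym f-inj q↝mq))
  ... | tri≈ _ mp≡mq _ =
    ⊥-elim (p≁q (↝-trans p↝mp (subst (_↝⟨ f ⟩ q) (sym (Finₚ.toℕ-injective mp≡mq)) (↝-sym f-inj q↝mq))))

-- The g-cycle of p is the f-arc from f q round to p, which never meets q.
module _ {d} {f g : Fin d → Fin d} (f-inj : Injective _≡_ _≡_ f) {p q : Fin d}
         (tr : Transposed f g p q) (p↝q : p ↝⟨ f ⟩ q) where
  open Transposed tr

  private
    HitsPBeforeQ : Fin d → Set
    HitsPBeforeQ z = ∃[ j ] iter f j z ≡ p × (∀ i → i ≤ j → iter f i z ≢ q)

    fq-hits : HitsPBeforeQ (f q)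
    fq-hits with shortest-path f (↝-sym f-inj p↝q)
    ... | zero  , q≡p , _        = ⊥-elim (p≢q (sym q≡p))
    ... | suc r , eq  , shortest = r , trans (iter-suc f r q) eq , before
      where
      before : ∀ i → i ≤ r → iter f i (f q) ≢ q
      before i i≤r hit = shortest (r ∸ i) (s≤s (m∸n≤m r i)) (begin
        iter f (r ∸ i) q                  ≡⟨ cong (iter f (r ∸ i)) (trans (sym (iter-suc f i q)) hit) ⟨
        iter f (r ∸ i) (iter f (suc i) q) ≡⟨ iter-+ f (r ∸ i) (suc i) q ⟨
        iter f (r ∸ i + suc i) q          ≡⟨ cong (λ m → iter f m q) (+-suc (r ∸ i) i) ⟩
        iter f (suc (r ∸ i + i)) q        ≡⟨ cong (λ m → iter f (suc m) q) (m∸n+n≡m i≤r) ⟩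
        iter f (suc r) q                  ≡⟨ eq ⟩
        p                                 ∎)
        where open ≡-Reasoning

    hits-step : ∀ {z} → HitsPBeforeQ z → HitsPBeforeQ (g z)
    hits-step {z} hits with z Finₚ.≟ p
    ... | yes refl = subst HitsPBeforeQ (sym at-p) fq-hits
    ... | no z≢p with hits
    ...   | zero  , z≡p , _      = ⊥-elim (z≢p z≡p)
    ...   | suc j , eq  , before = subst HitsPBeforeQ (sym (elsewhere z z≢p (before 0 z≤n)))
            (j , trans (iter-suc f j z) eq , λ i i≤j hit → before (suc i) (s≤s i≤j) (trans (sym (iter-suc f i z)) hit))

    hits-iter : ∀ k → HitsPBeforeQ (iter g k p)
    hits-iter zero    = 0 , refl , λ { zero _ → p≢q }
    hits-iter (suc k) = hits-step (hits-iter k)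

    p≁q : ¬ p ↝⟨ g ⟩ q
    p≁q (k , refl) = proj₂ (proj₂ (hits-iter k)) 0 z≤n refl

  orbitCount-split : Injective _≡_ _≡_ g → orbitCount g ≡ suc (orbitCount f)
  orbitCount-split g-inj = Merge.orbitCount-merge g-inj f-inj (transposed-flip tr) p≁q

-- Disjoint sums

data SplitView m n : Fin (m + n) → Set where
  left  : ∀ x → SplitView m n (x ↑ˡ n)
  right : ∀ y → SplitView m n (m ↑ʳ y)

splitView : ∀ m n z → SplitView m n z
splitView m n z with splitAt m z in eq
... | inj₁ x = subst (SplitView m n) (Finₚ.splitAt⁻¹-↑ˡ eq) (left x)
... | inj₂ y = subst (SplitView m n) (Finₚ.splitAt⁻¹-↑ʳ eq) (right y)

↑ˡ≢↑ʳ : ∀ {m n} (x : Fin m) (y : Fin n) → x ↑ˡ n ≢ m ↑ʳ y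
↑ˡ≢↑ʳ {m} {n} x y eq = <⇒≢ (begin-strict
  toℕ (x ↑ˡ n) ≡⟨ Finₚ.toℕ-↑ˡ x n ⟩
  toℕ x        <⟨ ≤-trans (Finₚ.toℕ<n x) (m≤m+n m (toℕ y)) ⟩
  m + toℕ y    ≡⟨ Finₚ.toℕ-↑ʳ m y ⟨
  toℕ (m ↑ʳ y) ∎) (cong toℕ eq)
  where open ≤-Reasoning

infixr 5 _⊕_

_⊕_ : ∀ {m n} → (Fin m → Fin m) → (Fin n → Fin n) → Fin (m + n) → Fin (m + n)
_⊕_ {m} {n} f g z = join m n (Sum.map f g (splitAt m z))

module _ {m n} (f : Fin m → Fin m) (g : Fin n → Fin n) where

  ⊕-↑ˡ : ∀ x → (f ⊕ g) (x ↑ˡ n) ≡ f x ↑ˡ n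
  ⊕-↑ˡ x rewrite Finₚ.splitAt-↑ˡ m x n = refl

  ⊕-↑ʳ : ∀ y → (f ⊕ g) (m ↑ʳ y) ≡ m ↑ʳ g y
  ⊕-↑ʳ y rewrite Finₚ.splitAt-↑ʳ m n y = refl

  iter-⊕-↑ˡ : ∀ k x → iter (f ⊕ g) k (x ↑ˡ n) ≡ iter f k x ↑ˡ n
  iter-⊕-↑ˡ zero    x = refl
  iter-⊕-↑ˡ (suc k) x = trans (cong (f ⊕ g) (iter-⊕-↑ˡ k x)) (⊕-↑ˡ _)

  iter-⊕-↑ʳ : ∀ k y → iter (f ⊕ g) k (m ↑ʳ y) ≡ m ↑ʳ iter g k y
  iter-⊕-↑ʳ zero    y = refl
  iter-⊕-↑ʳ (suc k) y = trans (cong (f ⊕ g) (iter-⊕-↑ʳ k y)) (⊕-↑ʳ _)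

  ↝-⊕-↑ˡ : ∀ {x z} → x ↝⟨ f ⟩ z → x ↑ˡ n ↝⟨ f ⊕ g ⟩ z ↑ˡ n
  ↝-⊕-↑ˡ {x} (k , refl) = k , iter-⊕-↑ˡ k x

  ↝-⊕-↑ʳ : ∀ {y z} → y ↝⟨ g ⟩ z → m ↑ʳ y ↝⟨ f ⊕ g ⟩ m ↑ʳ z
  ↝-⊕-↑ʳ {y} (k , refl) = k , iter-⊕-↑ʳ k y

  ↝-⊕-↑ˡ⁻ : ∀ {x z} → x ↑ˡ n ↝⟨ f ⊕ g ⟩ z → ∃[ y ] z ≡ y ↑ˡ n × x ↝⟨ f ⟩ y
  ↝-⊕-↑ˡ⁻ {x} (k , refl) = iter f k x , iter-⊕-↑ˡ k x , (k , refl)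

  ↝-⊕-↑ʳ⁻ : ∀ {y z} → m ↑ʳ y ↝⟨ f ⊕ g ⟩ z → ∃[ w ] z ≡ m ↑ʳ w × y ↝⟨ g ⟩ w
  ↝-⊕-↑ʳ⁻ {y} (k , refl) = iter g k y , iter-⊕-↑ʳ k y , (k , refl)

  ⊕-injective : Injective _≡_ _≡_ f → Injective _≡_ _≡_ g → Injective _≡_ _≡_ (f ⊕ g)
  ⊕-injective f-inj g-inj {a} {b} eq with splitView m n a | splitView m n b
  ... | left x  | left y  = cong (_↑ˡ n) (f-inj (Finₚ.↑ˡ-injective n _ _ (trans (sym (⊕-↑ˡ x)) (trans eq (⊕-↑ˡ y)))))
  ... | left x  | right y = ⊥-elim (↑ˡ≢↑ʳ _ _ (trans (sym (⊕-↑ˡ x)) (trans eq (⊕-↑ʳ y))))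
  ... | right x | left y  = ⊥-elim (↑ˡ≢↑ʳ _ _ (trans (sym (⊕-↑ˡ y)) (trans (sym eq) (⊕-↑ʳ x))))
  ... | right x | right y = cong (m ↑ʳ_) (g-inj (Finₚ.↑ʳ-injective m _ _ (trans (sym (⊕-↑ʳ x)) (trans eq (⊕-↑ʳ y)))))

  orbitCount-⊕ : Injective _≡_ _≡_ f → Injective _≡_ _≡_ g → orbitCount (f ⊕ g) ≡ orbitCount f + orbitCount g
  orbitCount-⊕ f-inj g-inj = begin
    orbitCount (f ⊕ g)                                        ≡⟨ orbitCount≡∑ (f ⊕ g) ⟩
    ∑ (orbitIndicator (f ⊕ g))                                ≡⟨ ∑-↑ m (orbitIndicator (f ⊕ g)) ⟩
    ∑ (λ x → orbitIndicator (f ⊕ g) (x ↑ˡ n)) + ∑ (λ y → orbitIndicator (f ⊕ g) (m ↑ʳ y))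
      ≡⟨ cong₂ _+_ (sum-cong-≗ λ x → orbitIndicator-cong ⊕-inj f-inj {x ↑ˡ n} (mk⇔ min-↑ˡ⁻ min-↑ˡ))
                   (sum-cong-≗ λ y → orbitIndicator-cong ⊕-inj g-inj {m ↑ʳ y} (mk⇔ min-↑ʳ⁻ min-↑ʳ)) ⟩
    ∑ (orbitIndicator f) + ∑ (orbitIndicator g)               ≡⟨ cong₂ _+_ (orbitCount≡∑ f) (orbitCount≡∑ g) ⟨
    orbitCount f + orbitCount g                               ∎
    where
    open ≡-Reasoning
    ⊕-inj = ⊕-injective f-inj g-inj
    min-↑ˡ : ∀ {x} → OrbitMin f x → OrbitMin (f ⊕ g) (x ↑ˡ n)
    min-↑ˡ {x} min z x↝z with ↝-⊕-↑ˡ⁻ x↝z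
    ... | y , refl , x↝y = subst₂ _≤_ (sym (Finₚ.toℕ-↑ˡ x n)) (sym (Finₚ.toℕ-↑ˡ y n)) (min y x↝y)
    min-↑ˡ⁻ : ∀ {x} → OrbitMin (f ⊕ g) (x ↑ˡ n) → OrbitMin f x
    min-↑ˡ⁻ {x} min y x↝y = subst₂ _≤_ (Finₚ.toℕ-↑ˡ x n) (Finₚ.toℕ-↑ˡ y n) (min _ (↝-⊕-↑ˡ x↝y))
    min-↑ʳ : ∀ {y} → OrbitMin g y → OrbitMin (f ⊕ g) (m ↑ʳ y)
    min-↑ʳ {y} min z y↝z with ↝-⊕-↑ʳ⁻ y↝z
    ... | w , refl , y↝w = subst₂ _≤_ (sym (Finₚ.toℕ-↑ʳ m y)) (sym (Finₚ.toℕ-↑ʳ m w)) (+-monoʳ-≤ m (min w y↝w))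
    min-↑ʳ⁻ : ∀ {y} → OrbitMin (f ⊕ g) (m ↑ʳ y) → OrbitMin g y
    min-↑ʳ⁻ {y} min w y↝w = +-cancelˡ-≤ m _ _ (subst₂ _≤_ (Finₚ.toℕ-↑ʳ m y) (Finₚ.toℕ-↑ʳ m w) (min _ (↝-⊕-↑ʳ y↝w)))

⊕-inverse : ∀ {m n} {f f′ : Fin m → Fin m} {g g′ : Fin n → Fin n} →
  (∀ x → f′ (f x) ≡ x) → (∀ y → g′ (g y) ≡ y) → ∀ z → (f′ ⊕ g′) ((f ⊕ g) z) ≡ z
⊕-inverse {m} {n} {f} {f′} {g} {g′} f′∘f g′∘g z with splitView m n z
... | left x  = trans (cong (f′ ⊕ g′) (⊕-↑ˡ f g x)) (trans (⊕-↑ˡ f′ g′ (f x)) (cong (_↑ˡ n) (f′∘f x)))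
... | right y = trans (cong (f′ ⊕ g′) (⊕-↑ʳ f g y)) (trans (⊕-↑ʳ f′ g′ (g y)) (cong (m ↑ʳ_) (g′∘g y)))

_⊕ₚ_ : ∀ {m n} → Permutation′ m → Permutation′ n → Permutation′ (m + n)
π ⊕ₚ ρ = permutation ((π ⟨$⟩ʳ_) ⊕ (ρ ⟨$⟩ʳ_)) ((π ⟨$⟩ˡ_) ⊕ (ρ ⟨$⟩ˡ_))
  (⊕-inverse (λ _ → inverseʳ π) (λ _ → inverseʳ ρ))
  (⊕-inverse (λ _ → inverseˡ π) (λ _ → inverseˡ ρ))

x∉p-x : ∀ {n} (p : Subset n) x → x ∉ p - x
x∉p-x (inside  ∷ p) zero    ()
x∉p-x (outside ∷ p) zero    ()
x∉p-x (inside  ∷ p) (suc x) (there x∈) = x∉p-x p x x∈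
x∉p-x (outside ∷ p) (suc x) (there x∈) = x∉p-x p x x∈

module _ {n : ℕ} where

  x∈p-y⇒x≢y : ∀ {p : Subset n} {x y} → x ∈ p - y → x ≢ y
  x∈p-y⇒x≢y {p} {x} x∈ refl = x∉p-x p x x∈

  x∈p-y⇒x∈p : ∀ {p : Subset n} {x y} → x ∈ p - y → x ∈ p
  x∈p-y⇒x∈p {p} {y = y} = p─q⊆p p ⁅ y ⁆

∣p-x∣ : ∀ {n} (p : Subset n) {x} → x ∈ p → suc ∣ p - x ∣ ≡ ∣ p ∣
∣p-x∣ (inside  ∷ p) {zero}  here       = cong suc (cong ∣_∣ (p─⊥≡p p))
∣p-x∣ (inside  ∷ p) {suc x} (there x∈) = cong suc (∣p-x∣ p x∈)
∣p-x∣ (outside ∷ p) {suc x} (there x∈) = ∣p-x∣ p x∈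

∣p∪⁅x⁆∣ : ∀ {n} (p : Subset n) {x} → x ∉ p → ∣ p ∪ ⁅ x ⁆ ∣ ≡ suc ∣ p ∣
∣p∪⁅x⁆∣ (inside  ∷ p) {zero}  x∉ = ⊥-elim (x∉ here)
∣p∪⁅x⁆∣ (outside ∷ p) {zero}  x∉ = cong suc (cong ∣_∣ (∪-identityʳ p))
∣p∪⁅x⁆∣ (inside  ∷ p) {suc x} x∉ = cong suc (∣p∪⁅x⁆∣ p (x∉ ∘ there))
∣p∪⁅x⁆∣ (outside ∷ p) {suc x} x∉ = ∣p∪⁅x⁆∣ p (x∉ ∘ there)

∣∁p∣+∣p∣ : ∀ {n} (p : Subset n) → ∣ ∁ p ∣ + ∣ p ∣ ≡ n
∣∁p∣+∣p∣ {n} p = trans (cong (_+ ∣ p ∣) (∣∁p∣≡n∸∣p∣ p)) (m∸n+n≡m (∣p∣≤n p))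

x∈p∪⁅x⁆ : ∀ {n} (p : Subset n) x → x ∈ p ∪ ⁅ x ⁆
x∈p∪⁅x⁆ p x = x∈p∪q⁺ {p = p} (inj₂ (x∈⁅x⁆ x))

-- Cyclic order on Fin k

toℕ-next-< : ∀ {k} (i : Fin k) → suc (toℕ i) < k → toℕ (next i) ≡ suc (toℕ i)
toℕ-next-< {suc k} i lt = trans (Finₚ.toℕ-fromℕ< _) (m<n⇒m%n≡m lt)

toℕ-next-last : ∀ {k} (i : Fin k) → suc (toℕ i) ≡ k → toℕ (next i) ≡ 0
toℕ-next-last {suc k} i eq = trans (Finₚ.toℕ-fromℕ< _) (trans (cong (_% suc k) eq) (n%n≡0 (suc k)))

next-injective : ∀ {k} → Injective _≡_ _≡_ (next {k})
next-injective {k} {i} {j} eq with m≤n⇒m<n∨m≡n (Finₚ.toℕ<n i) | m≤n⇒m<n∨m≡n (Finₚ.toℕ<n j)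
... | inj₁ i< | inj₁ j< =
  Finₚ.toℕ-injective (suc-injective (trans (sym (toℕ-next-< i i<)) (trans (cong toℕ eq) (toℕ-next-< j j<))))
... | inj₁ i< | inj₂ j≡ =
  ⊥-elim (0≢1+n (trans (sym (toℕ-next-last j j≡)) (trans (cong toℕ (sym eq)) (toℕ-next-< i i<))))
... | inj₂ i≡ | inj₁ j< =
  ⊥-elim (0≢1+n (trans (sym (toℕ-next-last i i≡)) (trans (cong toℕ eq) (toℕ-next-< j j<))))
... | inj₂ i≡ | inj₂ j≡ = Finₚ.toℕ-injective (suc-injective (trans i≡ (sym j≡)))

iter-next-zero-fromℕ< : ∀ {k} m (m<k : m < suc k) → iter next m (zero {k}) ≡ fromℕ< m<k
iter-next-zero-fromℕ< zero    _   = refl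
iter-next-zero-fromℕ< {k} (suc m) m<k = Finₚ.toℕ-injective (begin
  toℕ (next (iter next m zero))   ≡⟨ cong (toℕ ∘ next) (iter-next-zero-fromℕ< m m<k′) ⟩
  toℕ (next (fromℕ< m<k′))        ≡⟨ toℕ-next-< (fromℕ< m<k′) 1+m<1+k ⟩
  suc (toℕ (fromℕ< m<k′))         ≡⟨ cong suc (Finₚ.toℕ-fromℕ< m<k′) ⟩
  suc m                           ≡⟨ Finₚ.toℕ-fromℕ< m<k ⟨
  toℕ (fromℕ< m<k)                ∎)
  where
  open ≡-Reasoning
  m<k′ : m < suc k
  m<k′ = <-trans (n<1+n m) m<k
  1+m<1+k : suc (toℕ (fromℕ< m<k′)) < suc k
  1+m<1+k = subst (λ z → suc z < suc k) (sym (Finₚ.toℕ-fromℕ< m<k′)) m<k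

iter-next-zero : ∀ {k} (i : Fin (suc k)) → iter next (toℕ i) zero ≡ i
iter-next-zero i = trans (iter-next-zero-fromℕ< (toℕ i) (Finₚ.toℕ<n i)) (Finₚ.fromℕ<-toℕ i _)

iter-next-period : ∀ {k} (i : Fin (suc k)) → iter next (suc k) i ≡ i
iter-next-period {k} i = begin
  iter next (suc k) i                          ≡⟨ cong (iter next (suc k)) (iter-next-zero i) ⟨
  iter next (suc k) (iter next (toℕ i) zero)   ≡⟨ iter-comm next (suc k) (toℕ i) zero ⟩
  iter next (toℕ i) (iter next (suc k) zero)   ≡⟨ cong (iter next (toℕ i)) wraps ⟩
  iter next (toℕ i) zero                       ≡⟨ iter-next-zero i ⟩
  i                                            ∎
  where
  open ≡-Reasoning
  wraps : iter next (suc k) zero ≡ zero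
  wraps = Finₚ.toℕ-injective (trans (cong (toℕ ∘ next) (iter-next-zero-fromℕ< k (n<1+n k)))
                                    (toℕ-next-last _ (cong suc (Finₚ.toℕ-fromℕ< _))))

rotate : ∀ {k} → Fin k → Fin k → Fin k
rotate p i = iter next (toℕ i) p

rotate-next : ∀ {k} (p i : Fin k) → rotate p (next i) ≡ next (rotate p i)
rotate-next {suc k} p i with m≤n⇒m<n∨m≡n (Finₚ.toℕ<n i)
... | inj₁ i<k = cong (λ m → iter next m p) (toℕ-next-< i i<k)
... | inj₂ i≡k = trans (cong (λ m → iter next m p) (toℕ-next-last i i≡k))
                       (sym (trans (cong (λ m → iter next m p) i≡k) (iter-next-period p)))

rotate-injective : ∀ {k} (p : Fin k) → Injective _≡_ _≡_ (rotate p)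
rotate-injective {suc k} p {i} {j} eq = trans (sym (unrotate i)) (trans (cong (iter next (suc k ∸ toℕ p)) eq) (unrotate j))
  where
  open ≡-Reasoning
  back-to-zero : iter next (suc k ∸ toℕ p) p ≡ zero
  back-to-zero = begin
    iter next (suc k ∸ toℕ p) p                          ≡⟨ cong (iter next (suc k ∸ toℕ p)) (iter-next-zero p) ⟨
    iter next (suc k ∸ toℕ p) (iter next (toℕ p) zero)   ≡⟨ iter-+ next (suc k ∸ toℕ p) (toℕ p) zero ⟨
    iter next (suc k ∸ toℕ p + toℕ p) zero               ≡⟨ cong (λ m → iter next m zero) (m∸n+n≡m (<⇒≤ (Finₚ.toℕ<n p))) ⟩
    iter next (suc k) zero                               ≡⟨ iter-next-period zero ⟩
    zero                                                 ∎
  unrotate : ∀ i → iter next (suc k ∸ toℕ p) (rotate p i) ≡ i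
  unrotate i = begin
    iter next (suc k ∸ toℕ p) (iter next (toℕ i) p)   ≡⟨ iter-comm next (suc k ∸ toℕ p) (toℕ i) p ⟩
    iter next (toℕ i) (iter next (suc k ∸ toℕ p) p)   ≡⟨ cong (iter next (toℕ i)) back-to-zero ⟩
    iter next (toℕ i) zero                            ≡⟨ iter-next-zero i ⟩
    i                                                 ∎

rotate-surjective : ∀ {k} (p j : Fin k) → ∃[ i ] rotate p i ≡ j
rotate-surjective {suc k} p j with ↝-bounded next-injective p↝j
  where
  p↝j : p ↝⟨ next ⟩ j
  p↝j = ↝-trans (↝-sym next-injective (toℕ p , iter-next-zero p)) (toℕ j , iter-next-zero j)
... | m , m<k , eq = fromℕ< m<k , trans (cong (λ m → iter next m p) (Finₚ.toℕ-fromℕ< m<k)) eq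

module _ {m n : ℕ} where

  next-↑ˡ : ∀ (i : Fin (suc m)) → suc (toℕ i) < suc m → next (i ↑ˡ suc n) ≡ next i ↑ˡ suc n
  next-↑ˡ i i<m = Finₚ.toℕ-injective (begin
    toℕ (next (i ↑ˡ suc n)) ≡⟨ toℕ-next-< (i ↑ˡ suc n) (subst (λ k → suc k < suc m + suc n) (sym (Finₚ.toℕ-↑ˡ i (suc n)))
                                                           (<-≤-trans i<m (m≤m+n (suc m) (suc n)))) ⟩
    suc (toℕ (i ↑ˡ suc n))  ≡⟨ cong suc (Finₚ.toℕ-↑ˡ i (suc n)) ⟩
    suc (toℕ i)             ≡⟨ toℕ-next-< i i<m ⟨
    toℕ (next i)            ≡⟨ Finₚ.toℕ-↑ˡ (next i) (suc n) ⟨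
    toℕ (next i ↑ˡ suc n)   ∎)
    where open ≡-Reasoning

  next-↑ˡ-last : ∀ (i : Fin (suc m)) → suc (toℕ i) ≡ suc m → next (i ↑ˡ suc n) ≡ suc m ↑ʳ zero
  next-↑ˡ-last i i≡m = Finₚ.toℕ-injective (begin
    toℕ (next (i ↑ˡ suc n))   ≡⟨ toℕ-next-< (i ↑ˡ suc n) (subst (λ k → suc k < suc m + suc n) (sym (Finₚ.toℕ-↑ˡ i (suc n))) i<) ⟩
    suc (toℕ (i ↑ˡ suc n))    ≡⟨ cong suc (Finₚ.toℕ-↑ˡ i (suc n)) ⟩
    suc (toℕ i)               ≡⟨ i≡m ⟩
    suc m                     ≡⟨ +-identityʳ (suc m) ⟨
    suc m + 0                 ≡⟨ Finₚ.toℕ-↑ʳ (suc m) zero ⟨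
    toℕ (suc m ↑ʳ zero {n})   ∎)
    where
    open ≡-Reasoning
    i< : suc (toℕ i) < suc m + suc n
    i< = subst (_< suc m + suc n) (sym i≡m) (m<m+n (suc m) (s≤s z≤n))

  next-↑ʳ : ∀ (j : Fin (suc n)) → suc (toℕ j) < suc n → next (suc m ↑ʳ j) ≡ suc m ↑ʳ next j
  next-↑ʳ j j<n = Finₚ.toℕ-injective (begin
    toℕ (next (suc m ↑ʳ j))   ≡⟨ toℕ-next-< (suc m ↑ʳ j) (subst (λ k → suc k < suc m + suc n) (sym (Finₚ.toℕ-↑ʳ (suc m) j))
                                                             (subst (_< suc m + suc n) (+-suc (suc m) (toℕ j)) (+-monoʳ-< (suc m) j<n))) ⟩
    suc (toℕ (suc m ↑ʳ j))    ≡⟨ cong suc (Finₚ.toℕ-↑ʳ (suc m) j) ⟩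
    suc (suc m + toℕ j)       ≡⟨ +-suc (suc m) (toℕ j) ⟨
    suc m + suc (toℕ j)       ≡⟨ cong (suc m +_) (toℕ-next-< j j<n) ⟨
    suc m + toℕ (next j)      ≡⟨ Finₚ.toℕ-↑ʳ (suc m) (next j) ⟨
    toℕ (suc m ↑ʳ next j)     ∎)
    where open ≡-Reasoning

  next-↑ʳ-last : ∀ (j : Fin (suc n)) → suc (toℕ j) ≡ suc n → next (suc m ↑ʳ j) ≡ zero
  next-↑ʳ-last j j≡n = Finₚ.toℕ-injective (toℕ-next-last (suc m ↑ʳ j)
    (trans (cong suc (Finₚ.toℕ-↑ʳ (suc m) j)) (trans (sym (+-suc (suc m) (toℕ j))) (cong (suc m +_) j≡n))))

next-suc : ∀ {k} (j : Fin (suc k)) → suc (toℕ j) < suc k → next (suc j) ≡ suc (next j)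
next-suc j j<k = Finₚ.toℕ-injective (trans (toℕ-next-< (suc j) (s≤s j<k)) (cong suc (sym (toℕ-next-< j j<k))))

next-suc-last : ∀ {k} (j : Fin (suc k)) → suc (toℕ j) ≡ suc k → next (suc j) ≡ zero
next-suc-last j j≡k = Finₚ.toℕ-injective (toℕ-next-last (suc j) (cong suc j≡k))

-- Rotation systems

-- Each dart is counted in exactly one of the two sums, according to whether it precedes its partner.
even-darts : ∀ {d} (α : Permutation′ d) → (∀ x → α ⟨$⟩ʳ (α ⟨$⟩ʳ x) ≡ x) → (∀ x → α ⟨$⟩ʳ x ≢ x) →
  ∃[ c ] d ≡ c + c
even-darts {d} α invol free = ∑ before , (begin
  d                                 ≡⟨ sum-replicate-1 d ⟨
  ∑ {d} (λ _ → 1)                   ≡⟨ sum-cong-≗ exactly-one ⟨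
  ∑ (λ x → before x + after x)      ≡⟨ ∑-distrib-+ before after ⟩
  ∑ before + ∑ after                ≡⟨ cong (∑ before +_) after≡before ⟩
  ∑ before + ∑ before               ∎)
  where
  open ≡-Reasoning
  precedes : Fin d → Fin d → ℕ
  precedes x y with toℕ x ℕ.<? toℕ y
  ... | yes _ = 1
  ... | no _  = 0
  before after : Fin d → ℕ
  before x = precedes x (α ⟨$⟩ʳ x)
  after  x = precedes (α ⟨$⟩ʳ x) x
  after≡before : ∑ after ≡ ∑ before
  after≡before = trans (sum-cong-≗ λ x → cong (precedes (α ⟨$⟩ʳ x)) (sym (invol x))) (sym (sum-permute before α))
  exactly-one : ∀ x → before x + after x ≡ 1
  exactly-one x with toℕ x ℕ.<? toℕ (α ⟨$⟩ʳ x) | toℕ (α ⟨$⟩ʳ x) ℕ.<? toℕ x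
  ... | yes x<y | yes y<x = ⊥-elim (<-asym x<y y<x)
  ... | yes _   | no _    = refl
  ... | no _    | yes _   = refl
  ... | no x≮y  | no y≮x  = ⊥-elim (free x (Finₚ.toℕ-injective (≤-antisym (≮⇒≥ x≮y) (≮⇒≥ y≮x))))
  sum-replicate-1 : ∀ n → ∑ {n} (λ _ → 1) ≡ n
  sum-replicate-1 zero    = refl
  sum-replicate-1 (suc n) = cong suc (sum-replicate-1 n)

half-double : ∀ c → (c + c) / 2 ≡ c
half-double c = trans (cong (_/ 2) (trans (cong (c +_) (sym (+-identityʳ c))) (*-comm 2 c))) (m*n/n≡m c 2)

module _ {N} {S : Subset N} (M : Map S) where

  Reach-trans : ∀ {x y z} → Reach M x y → Reach M y z → Reach M x z
  Reach-trans here       r = r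
  Reach-trans (stepσ r′) r = stepσ (Reach-trans r′ r)
  Reach-trans (stepα r′) r = stepα (Reach-trans r′ r)

  ↝σ⇒Reach : ∀ {x y} → x ↝⟨ σ M ⟨$⟩ʳ_ ⟩ y → Reach M x y
  ↝σ⇒Reach {x} (k , refl) = walk k x
    where
    walk : ∀ k x → Reach M x (iter (σ M ⟨$⟩ʳ_) k x)
    walk zero    x = here
    walk (suc k) x = subst (Reach M x) (iter-suc (σ M ⟨$⟩ʳ_) k x) (stepσ (walk k _))

  tail-↝σ : ∀ {x y} → x ↝⟨ σ M ⟨$⟩ʳ_ ⟩ y → tail M x ≡ tail M y
  tail-↝σ {x} (k , refl) = sym (tail-iter k x)
    where
    tail-iter : ∀ k x → tail M (iter (σ M ⟨$⟩ʳ_) k x) ≡ tail M x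
    tail-iter zero    x = refl
    tail-iter (suc k) x = trans (σ-tail M _) (tail-iter k x)

  tail-σ⁻¹ : ∀ z → tail M (σ M ⟨$⟩ˡ z) ≡ tail M z
  tail-σ⁻¹ z = trans (sym (σ-tail M _)) (cong (tail M) (inverseʳ (σ M)))

  record RootedHamCycle (v : Fin N) : Set where
    field
      len    : ℕ
      h      : Fin (2 + len) → Fin N
      h∈S    : ∀ i → h i ∈ S
      h-onto : ∀ v → v ∈ S → ∃[ i ] h i ≡ v
      h-inj  : ∀ i j → h i ≡ h j → i ≡ j
      e      : Fin (2 + len) → Fin (d M)
      e-tail : ∀ i → tail M (e i) ≡ h i
      e-head : ∀ i → head M (e i) ≡ h (next i)
      e-dist : ∀ i j → i ≢ j → (e i ≢ e j) × (e i ≢ α M ⟨$⟩ʳ e j)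
      root   : h zero ≡ v

    last : Fin (2 + len)
    last = Fin.fromℕ (suc len)

    next-last : next last ≡ zero
    next-last = Finₚ.toℕ-injective (toℕ-next-last last (cong suc (Finₚ.toℕ-fromℕ (suc len))))

    next-zero : next (zero {suc len}) ≡ suc zero
    next-zero = Finₚ.toℕ-injective (toℕ-next-< (zero {suc len}) (s≤s (s≤s z≤n)))

    h-suc≢root : ∀ i → h (suc i) ≢ v
    h-suc≢root i eq with h-inj _ _ (trans eq (sym root))
    ... | ()

    find : Fin N → Fin (2 + len)
    find u with Finₚ.any? (λ i → h i Finₚ.≟ u)
    ... | yes (i , _) = i
    ... | no _        = zero

    h-find : ∀ {u} → u ∈ S → h (find u) ≡ u
    h-find {u} u∈S with Finₚ.any? (λ i → h i Finₚ.≟ u)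
    ... | yes (_ , eq) = eq
    ... | no none      = ⊥-elim (none (h-onto u u∈S))

    dartAt : Fin N → Fin (d M)
    dartAt u = e (find u)

    tail-dartAt : ∀ {u} → u ∈ S → tail M (dartAt u) ≡ u
    tail-dartAt u∈S = trans (e-tail _) (h-find u∈S)

  -- w only serves to show that the cycle has at least two vertices.
  rootAt : HamCycle M → ∀ {v w} → v ∈ S → w ∈ S → w ≢ v → RootedHamCycle v
  rootAt H {v} {w} v∈S w∈S w≢v = go (HamCycle.k H) (HamCycle.h H) (HamCycle.h∈S H) (HamCycle.h-onto H)
    (HamCycle.h-inj H) (HamCycle.e H) (HamCycle.e-tail H) (HamCycle.e-head H) (HamCycle.e-dist H)
    where
    go : ∀ k (h : Fin k → Fin N) → (∀ i → h i ∈ S) → (∀ v → v ∈ S → ∃[ i ] h i ≡ v) →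
         (∀ i j → h i ≡ h j → i ≡ j) → (e : Fin k → Fin (d M)) → (∀ i → tail M (e i) ≡ h i) →
         (∀ i → head M (e i) ≡ h (next i)) → (∀ i j → i ≢ j → (e i ≢ e j) × (e i ≢ α M ⟨$⟩ʳ e j)) →
         RootedHamCycle v
    go zero h _ h-onto _ _ _ _ _ = ⊥-elim (Finₚ.¬Fin0 (proj₁ (h-onto v v∈S)))
    go (suc zero) h _ h-onto _ _ _ _ _ with h-onto v v∈S | h-onto w w∈S
    ... | zero , hv | zero , hw = ⊥-elim (w≢v (trans (sym hw) hv))
    go (suc (suc len)) h h∈S h-onto h-inj e e-tail e-head e-dist with h-onto v v∈S
    ... | p , hp = record
      { len = len ; h = h ∘ rotate p ; h∈S = h∈S ∘ rotate p
      ; h-onto = λ u u∈S → let (j , hj) = h-onto u u∈S ; (i , ri) = rotate-surjective p j in i , trans (cong h ri) hj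
      ; h-inj = λ i j eq → rotate-injective p (h-inj _ _ eq)
      ; e = e ∘ rotate p ; e-tail = e-tail ∘ rotate p
      ; e-head = λ i → trans (e-head _) (cong h (sym (rotate-next p i)))
      ; e-dist = λ i j i≢j → e-dist _ _ (i≢j ∘ rotate-injective p)
      ; root = hp }

-- Contract the last cycle edge x : u → w.  The vertex w is renamed u and its rotation is spliced into
-- that of u right after x, so x becomes a loop: one vertex fewer, the same edges, and one face more
-- (the loop separates off a new face).  The cycle simply skips w.
module Contraction {N} (G : Graph N) {S : Subset N} {M : Map S} (planar : PlanarConnected M)
                   (contains : ContainsEdges G M) {w : Fin N} (H : RootedHamCycle M w) where
  open RootedHamCycle H

  σf αf : Fin (d M) → Fin (d M)
  σf = σ M ⟨$⟩ʳ_
  αf = α M ⟨$⟩ʳ_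

  u : Fin N
  u = h last

  x b : Fin (d M)
  x = e last
  b = σ M ⟨$⟩ˡ αf x

  u≢w : u ≢ w
  u≢w eq with h-inj _ _ (trans eq (sym root))
  ... | ()

  tail-x : tail M x ≡ u
  tail-x = e-tail last

  tail-b : tail M b ≡ w
  tail-b = trans (tail-σ⁻¹ M (αf x)) (trans (e-head last) (trans (cong h next-last) root))

  x≁b : ¬ x ↝⟨ σf ⟩ b
  x≁b x↝b = u≢w (trans (sym tail-x) (trans (tail-↝σ M x↝b) tail-b))

  x≢b : x ≢ b
  x≢b x≡b = x≁b (subst (x ↝⟨ σf ⟩_) x≡b ↝-refl)

  w∈S : w ∈ S
  w∈S = subst (_∈ S) root (h∈S zero)

  rename : Fin N → Fin N
  rename y with y Finₚ.≟ w
  ... | yes _ = u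
  ... | no _  = y

  rename-w : ∀ {y} → y ≡ w → rename y ≡ u
  rename-w {y} y≡w with y Finₚ.≟ w
  ... | yes _   = refl
  ... | no y≢w = ⊥-elim (y≢w y≡w)

  rename-≢w : ∀ {y} → y ≢ w → rename y ≡ y
  rename-≢w {y} y≢w with y Finₚ.≟ w
  ... | yes y≡w = ⊥-elim (y≢w y≡w)
  ... | no _    = refl

  tail′ : Fin (d M) → Fin N
  tail′ = rename ∘ tail M

  tail′∈ : ∀ z → tail′ z ∈ S - w
  tail′∈ z with tail M z Finₚ.≟ w
  ... | yes _   = x∈p∧x≢y⇒x∈p-y (h∈S last) u≢w
  ... | no t≢w = x∈p∧x≢y⇒x∈p-y (tail∈S M z) t≢w

  σ′ : Permutation′ (d M)
  σ′ = transpose x b ∘ₚ σ M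

  σ′f : Fin (d M) → Fin (d M)
  σ′f = σ′ ⟨$⟩ʳ_

  tail′-σ′ : ∀ z → tail′ (σ′f z) ≡ tail′ z
  tail′-σ′ z = trans (cong rename (σ-tail M _))
                     (transpose-preserves tail′ (trans (cong rename tail-x) (trans (rename-≢w u≢w) (sym (rename-w tail-b)))) z)

  module S′ = Merge (perm-injective (σ M)) (perm-injective σ′) (transposed σf x≢b) x≁b

  σ′-reaches-dartAt : ∀ z → z ↝⟨ σ′f ⟩ dartAt (tail′ z)
  σ′-reaches-dartAt z with tail M z Finₚ.≟ w
  ... | yes t≡w = ↝-trans (S′.↝-preserved (σ-cycle M z b (trans t≡w (sym tail-b))))
                 (↝-trans (↝-sym (perm-injective σ′) S′.p↝q)
                          (S′.↝-preserved (σ-cycle M x (dartAt u) (trans tail-x (sym (tail-dartAt (h∈S last)))))))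
  ... | no _   = S′.↝-preserved (σ-cycle M z _ (sym (tail-dartAt (tail∈S M z))))

  σ′-cycle : ∀ z y → tail′ z ≡ tail′ y → z ↝⟨ σ′f ⟩ y
  σ′-cycle z y eq = ↝-trans (σ′-reaches-dartAt z)
    (↝-sym (perm-injective σ′) (subst (λ v → y ↝⟨ σ′f ⟩ dartAt v) (sym eq) (σ′-reaches-dartAt y)))

  M′ : Map (S - w)
  M′ = record
    { d = d M ; tail = tail′ ; tail∈S = tail′∈ ; σ = σ′ ; α = α M ; α-invol = α-invol M ; α-free = α-free M
    ; σ-tail = tail′-σ′ ; σ-cycle = σ′-cycle }

  connected : Connected M′
  connected z y = reach (proj₁ planar z y)
    where
    reach : ∀ {z y} → Reach M z y → Reach M′ z y
    reach here = here
    reach {z} (stepσ r) = Reach-trans M′ (↝σ⇒Reach M′ (σ′-cycle z (σf z) (cong rename (sym (σ-tail M z))))) (reach r)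
    reach (stepα r) = stepα (reach r)

  faces : numFaces M′ ≡ suc (numFaces M)
  faces = orbitCount-split (perm-injective (α M) ∘ perm-injective (σ M))
    (transposed-∘ (transposed σf x≢b) αf (α-invol M)) αx↝αb (perm-injective (α M) ∘ perm-injective σ′)
    where
    αx↝αb : αf x ↝⟨ φ M ⟩ αf b
    αx↝αb = ↝-sym (perm-injective (α M) ∘ perm-injective (σ M)) (1 , trans (cong σf (α-invol M b)) (inverseʳ (σ M)))

  euler : numVertices M′ + numFaces M′ ≡ numEdges M′ + 2
  euler = begin
    ∣ S - w ∣ + numFaces M′        ≡⟨ cong (∣ S - w ∣ +_) faces ⟩
    ∣ S - w ∣ + suc (numFaces M)   ≡⟨ +-suc ∣ S - w ∣ _ ⟩
    suc ∣ S - w ∣ + numFaces M     ≡⟨ cong (_+ numFaces M) (∣p-x∣ S w∈S) ⟩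
    ∣ S ∣ + numFaces M             ≡⟨ proj₂ planar ⟩
    numEdges M + 2                 ∎
    where open ≡-Reasoning

  contains′ : ContainsEdges G M′
  contains′ v₁ v₂ v₁∈ v₂∈ adj with contains v₁ v₂ (x∈p-y⇒x∈p v₁∈) (x∈p-y⇒x∈p v₂∈) adj
  ... | z , tz , hz =
    z , trans (cong rename tz) (rename-≢w (x∈p-y⇒x≢y v₁∈)) , trans (cong rename hz) (rename-≢w (x∈p-y⇒x≢y v₂∈))

  -- The new cycle visits h 1, …, h (1 + len) = u and returns to h 1 along e 0, whose tail w is now u.
  edgeIndex : Fin (1 + len) → Fin (2 + len)
  edgeIndex j with toℕ j ℕ.≟ len
  ... | yes _ = zero
  ... | no _  = suc j

  edgeIndex-last : ∀ {j} → toℕ j ≡ len → edgeIndex j ≡ zero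
  edgeIndex-last {j} j≡len with toℕ j ℕ.≟ len
  ... | yes _     = refl
  ... | no j≢len = ⊥-elim (j≢len j≡len)

  edgeIndex-suc : ∀ {j} → toℕ j ≢ len → edgeIndex j ≡ suc j
  edgeIndex-suc {j} j≢len with toℕ j ℕ.≟ len
  ... | yes j≡len = ⊥-elim (j≢len j≡len)
  ... | no _      = refl

  edgeIndex-view : ∀ j → (toℕ j ≡ len × edgeIndex j ≡ zero) ⊎ (toℕ j ≢ len × edgeIndex j ≡ suc j)
  edgeIndex-view j = view (toℕ j ℕ.≟ len)
    where
    view : Dec (toℕ j ≡ len) → (toℕ j ≡ len × edgeIndex j ≡ zero) ⊎ (toℕ j ≢ len × edgeIndex j ≡ suc j)
    view (yes j≡len) = inj₁ (j≡len , edgeIndex-last j≡len)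
    view (no j≢len)  = inj₂ (j≢len , edgeIndex-suc j≢len)

  edgeIndex-injective : ∀ i j → edgeIndex i ≡ edgeIndex j → i ≡ j
  edgeIndex-injective i j eq with edgeIndex-view i | edgeIndex-view j
  ... | inj₁ (i≡ , _)  | inj₁ (j≡ , _)  = Finₚ.toℕ-injective (trans i≡ (sym j≡))
  ... | inj₁ (_ , ei)  | inj₂ (_ , ej)  with () ← trans (sym ei) (trans eq ej)
  ... | inj₂ (_ , ei)  | inj₁ (_ , ej)  with () ← trans (sym ej) (trans (sym eq) ei)
  ... | inj₂ (_ , ei)  | inj₂ (_ , ej)  = Finₚ.suc-injective (trans (sym ei) (trans eq ej))

  suc-last : ∀ {j} → toℕ j ≡ len → suc j ≡ last
  suc-last j≡len = Finₚ.toℕ-injective (trans (cong suc j≡len) (sym (Finₚ.toℕ-fromℕ (suc len))))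

  cycle : HamCycle M′
  cycle = record
    { k = suc len ; h = h ∘ suc
    ; h∈S = λ j → x∈p∧x≢y⇒x∈p-y (h∈S _) (h-suc≢root j)
    ; h-onto = onto
    ; h-inj = λ i j eq → Finₚ.suc-injective (h-inj _ _ eq)
    ; e = e ∘ edgeIndex ; e-tail = tail-edge ; e-head = head-edge
    ; e-dist = λ i j i≢j → e-dist _ _ (i≢j ∘ edgeIndex-injective i j) }
    where
    onto : ∀ v → v ∈ S - w → ∃[ j ] h (suc j) ≡ v
    onto v v∈ with h-onto v (x∈p-y⇒x∈p v∈)
    ... | zero  , hv = ⊥-elim (x∈p-y⇒x≢y v∈ (trans (sym hv) root))
    ... | suc j , hv = j , hv

    tail-edge : ∀ j → tail′ (e (edgeIndex j)) ≡ h (suc j)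
    tail-edge j with edgeIndex-view j
    ... | inj₁ (j≡len , ej) = begin
      rename (tail M (e (edgeIndex j))) ≡⟨ cong (rename ∘ tail M ∘ e) ej ⟩
      rename (tail M (e zero))           ≡⟨ rename-w (trans (e-tail zero) root) ⟩
      h last                             ≡⟨ cong h (suc-last j≡len) ⟨
      h (suc j)                          ∎
      where open ≡-Reasoning
    ... | inj₂ (_ , ej) = begin
      rename (tail M (e (edgeIndex j))) ≡⟨ cong (rename ∘ tail M ∘ e) ej ⟩
      rename (tail M (e (suc j)))        ≡⟨ cong rename (e-tail (suc j)) ⟩
      rename (h (suc j))                 ≡⟨ rename-≢w (h-suc≢root j) ⟩
      h (suc j)                          ∎
      where open ≡-Reasoning

    head-edge : ∀ j → tail′ (α M ⟨$⟩ʳ e (edgeIndex j)) ≡ h (suc (next j))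
    head-edge j with edgeIndex-view j
    ... | inj₁ (j≡len , ej) = begin
      rename (head M (e (edgeIndex j))) ≡⟨ cong (rename ∘ head M ∘ e) ej ⟩
      rename (head M (e zero))           ≡⟨ cong rename (trans (e-head zero) (cong h next-zero)) ⟩
      rename (h (suc zero))              ≡⟨ rename-≢w (h-suc≢root zero) ⟩
      h (suc zero)                       ≡⟨ cong (h ∘ suc) (Finₚ.toℕ-injective (toℕ-next-last j (cong suc j≡len))) ⟨
      h (suc (next j))                   ∎
      where open ≡-Reasoning
    ... | inj₂ (j≢len , ej) = begin
      rename (head M (e (edgeIndex j))) ≡⟨ cong (rename ∘ head M ∘ e) ej ⟩
      rename (head M (e (suc j)))        ≡⟨ cong rename (e-head (suc j)) ⟩
      rename (h (next (suc j)))          ≡⟨ cong (rename ∘ h) (next-suc j (≤∧≢⇒< (Finₚ.toℕ<n j) (j≢len ∘ suc-injective))) ⟩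
      rename (h (suc (next j)))          ≡⟨ rename-≢w (h-suc≢root (next j)) ⟩
      h (suc (next j))                   ∎
      where open ≡-Reasoning

  contracted : Subhamiltonian G (S - w)
  contracted = M′ , (connected , euler) , contains′ , cycle

module _ {N} (G : Graph N) where

  subhamiltonian-remove : ∀ {S w v} → Subhamiltonian G S → w ∈ S → v ∈ S → v ≢ w → Subhamiltonian G (S - w)
  subhamiltonian-remove (M , planar , contains , H) w∈S v∈S v≢w =
    Contraction.contracted G planar contains (rootAt M H w∈S v∈S v≢w)

  subhamiltonian-⊆ : ∀ {S S′ v} → Subhamiltonian G S → S′ ⊆ S → v ∈ S′ → Subhamiltonian G S′
  subhamiltonian-⊆ {S} {S′} {v} sh S′⊆S v∈S′ = shrink ∣ S ∣ ≤-refl sh S′⊆S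
    where
    shrink : ∀ fuel {S} → ∣ S ∣ ≤ fuel → Subhamiltonian G S → S′ ⊆ S → Subhamiltonian G S′
    shrink fuel {S} size sh S′⊆S with Finₚ.any? (λ w → (w ∈? S) ×-dec ¬? (w ∈? S′))
    ... | no none = subst (Subhamiltonian G) (⊆-antisym S⊆S′ S′⊆S) sh
      where
      S⊆S′ : S ⊆ S′
      S⊆S′ {y} y∈S = decidable-stable (y ∈? S′) (λ y∉S′ → none (y , y∈S , y∉S′))
    ... | yes (w , w∈S , w∉S′) with fuel | ≤-trans (x∈p⇒∣p-x∣<∣p∣ w∈S) size
    ...   | suc fuel | smaller =
      shrink fuel (≤-pred smaller) (subhamiltonian-remove sh w∈S (S′⊆S v∈S′) (≢w v∈S′)) (λ y∈S′ → x∈p∧x≢y⇒x∈p-y (S′⊆S y∈S′) (≢w y∈S′))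
      where
      ≢w : ∀ {y} → y ∈ S′ → y ≢ w
      ≢w y∈S′ y≡w = w∉S′ (subst (_∈ S′) y≡w y∈S′)

-- Gluing two maps at a vertex

euler-glued : ∀ {V₁ V₂ F₁ F₂ E₁ E₂} → V₁ + F₁ ≡ E₁ + 2 → suc V₂ + F₂ ≡ E₂ + 2 →
  (V₁ + V₂) + (F₁ + F₂) ≡ (E₁ + E₂ + 1) + 2
euler-glued {V₁} {V₂} {F₁} {F₂} {E₁} {E₂} euler₁ euler₂ = suc-injective (begin
  suc ((V₁ + V₂) + (F₁ + F₂))   ≡⟨ regroup V₁ V₂ F₁ F₂ ⟩
  (V₁ + F₁) + (suc V₂ + F₂)     ≡⟨ cong₂ _+_ euler₁ euler₂ ⟩
  (E₁ + 2) + (E₂ + 2)           ≡⟨ collect E₁ E₂ ⟩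
  suc ((E₁ + E₂ + 1) + 2)       ∎)
  where
  open ≡-Reasoning
  open +-*-Solver
  regroup : ∀ V₁ V₂ F₁ F₂ → suc ((V₁ + V₂) + (F₁ + F₂)) ≡ (V₁ + F₁) + (suc V₂ + F₂)
  regroup = solve 4 (λ V₁ V₂ F₁ F₂ → con 1 :+ ((V₁ :+ V₂) :+ (F₁ :+ F₂)) := (V₁ :+ F₁) :+ ((con 1 :+ V₂) :+ F₂)) refl
  collect : ∀ E₁ E₂ → (E₁ + 2) + (E₂ + 2) ≡ suc ((E₁ + E₂ + 1) + 2)
  collect = solve 2 (λ E₁ E₂ → (E₁ :+ con 2) :+ (E₂ :+ con 2) := con 1 :+ ((E₁ :+ E₂ :+ con 1) :+ con 2)) refl

module Blocks (m n : ℕ) where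

  Dart : Set
  Dart = Fin ((m + n) + 2)

  inl : Fin m → Dart
  inl x = (x ↑ˡ n) ↑ˡ 2

  inr : Fin n → Dart
  inr y = (m ↑ʳ y) ↑ˡ 2

  new : Fin 2 → Dart
  new s = (m + n) ↑ʳ s

  data View : Dart → Set where
    inl-view : ∀ x → View (inl x)
    inr-view : ∀ y → View (inr y)
    new-view : ∀ s → View (new s)

  view : ∀ z → View z
  view z with splitView (m + n) 2 z
  ... | right s = new-view s
  ... | left w with splitView m n w
  ...   | left x  = inl-view x
  ...   | right y = inr-view y

  inl-injective : Injective _≡_ _≡_ inl
  inl-injective eq = Finₚ.↑ˡ-injective n _ _ (Finₚ.↑ˡ-injective 2 _ _ eq)

  inr-injective : Injective _≡_ _≡_ inr
  inr-injective eq = Finₚ.↑ʳ-injective m _ _ (Finₚ.↑ˡ-injective 2 _ _ eq)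

  inl≢inr : ∀ {x y} → inl x ≢ inr y
  inl≢inr eq = ↑ˡ≢↑ʳ _ _ (Finₚ.↑ˡ-injective 2 _ _ eq)

  inl≢new : ∀ {x s} → inl x ≢ new s
  inl≢new = ↑ˡ≢↑ʳ _ _

  inr≢new : ∀ {y s} → inr y ≢ new s
  inr≢new = ↑ˡ≢↑ʳ _ _

  new0≢new1 : new zero ≢ new (suc zero)
  new0≢new1 eq with Finₚ.↑ʳ-injective (m + n) zero (suc zero) eq
  ... | ()

  caseDart : ∀ {A : Set} → (Fin m → A) → (Fin n → A) → (Fin 2 → A) → Dart → A
  caseDart f g k = [ [ f , g ]′ ∘ splitAt m , k ]′ ∘ splitAt (m + n)

  module _ {A : Set} (f : Fin m → A) (g : Fin n → A) (k : Fin 2 → A) where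

    caseDart-inl : ∀ x → caseDart f g k (inl x) ≡ f x
    caseDart-inl x rewrite Finₚ.splitAt-↑ˡ (m + n) (x ↑ˡ n) 2 | Finₚ.splitAt-↑ˡ m x n = refl

    caseDart-inr : ∀ y → caseDart f g k (inr y) ≡ g y
    caseDart-inr y rewrite Finₚ.splitAt-↑ˡ (m + n) (m ↑ʳ y) 2 | Finₚ.splitAt-↑ʳ m n y = refl

    caseDart-new : ∀ s → caseDart f g k (new s) ≡ k s
    caseDart-new s rewrite Finₚ.splitAt-↑ʳ (m + n) 2 s = refl

  block : Dart → Fin 3
  block = caseDart (λ _ → zero) (λ _ → suc zero) (λ _ → suc (suc zero))

  module _ (f₁ : Fin m → Fin m) (f₂ : Fin n → Fin n) (f₃ : Fin 2 → Fin 2) where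

    blockwise : Dart → Dart
    blockwise = (f₁ ⊕ f₂) ⊕ f₃

    blockwise-inl : ∀ x → blockwise (inl x) ≡ inl (f₁ x)
    blockwise-inl x = trans (⊕-↑ˡ (f₁ ⊕ f₂) f₃ _) (cong (_↑ˡ 2) (⊕-↑ˡ f₁ f₂ x))

    blockwise-inr : ∀ y → blockwise (inr y) ≡ inr (f₂ y)
    blockwise-inr y = trans (⊕-↑ˡ (f₁ ⊕ f₂) f₃ _) (cong (_↑ˡ 2) (⊕-↑ʳ f₁ f₂ y))

    blockwise-new : ∀ s → blockwise (new s) ≡ new (f₃ s)
    blockwise-new = ⊕-↑ʳ (f₁ ⊕ f₂) f₃

    ↝-inl : ∀ {x y} → x ↝⟨ f₁ ⟩ y → inl x ↝⟨ blockwise ⟩ inl y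
    ↝-inl r = ↝-⊕-↑ˡ (f₁ ⊕ f₂) f₃ (↝-⊕-↑ˡ f₁ f₂ r)

    ↝-inr : ∀ {x y} → x ↝⟨ f₂ ⟩ y → inr x ↝⟨ blockwise ⟩ inr y
    ↝-inr r = ↝-⊕-↑ˡ (f₁ ⊕ f₂) f₃ (↝-⊕-↑ʳ f₁ f₂ r)

    ↝-inl⁻ : ∀ {x z} → inl x ↝⟨ blockwise ⟩ z → ∃[ y ] z ≡ inl y
    ↝-inl⁻ r with ↝-⊕-↑ˡ⁻ (f₁ ⊕ f₂) f₃ r
    ... | _ , refl , r′ with ↝-⊕-↑ˡ⁻ f₁ f₂ r′
    ...   | y , refl , _ = y , refl

    ↝-inr⁻ : ∀ {x z} → inr x ↝⟨ blockwise ⟩ z → ∃[ y ] z ≡ inr y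
    ↝-inr⁻ r with ↝-⊕-↑ˡ⁻ (f₁ ⊕ f₂) f₃ r
    ... | _ , refl , r′ with ↝-⊕-↑ʳ⁻ f₁ f₂ r′
    ...   | y , refl , _ = y , refl

    ↝-new⁻ : ∀ {s z} → new s ↝⟨ blockwise ⟩ z → ∃[ s′ ] z ≡ new s′
    ↝-new⁻ r with ↝-⊕-↑ʳ⁻ (f₁ ⊕ f₂) f₃ r
    ... | s′ , refl , _ = s′ , refl

-- On darts: the disjoint union of the two maps and of the two darts t, t′ of the new edge ab, followed by
-- three transpositions of the rotation σ.  The first merges the two rotations at n, the other two insert
-- t at a and t′ at b.  The first two each merge two faces and the third splits one, so F = F₁ + F₂,
-- while V = V₁ + V₂ - 1 and E = E₁ + E₂ + 1.
module Glue {N} (G : Graph N) (C : Subset N) (n : Fin N) (n∉C : n ∉ C)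
            (separates : ∀ {v c} → v ∉ C → c ∈ C → Adj G v c → v ≡ n)
            {M₁ : Map (∁ C)} (planar₁ : PlanarConnected M₁) (contains₁ : ContainsEdges G M₁)
            (H₁ : RootedHamCycle M₁ n)
            {M₂ : Map (C ∪ ⁅ n ⁆)} (planar₂ : PlanarConnected M₂) (contains₂ : ContainsEdges G M₂)
            (H₂ : RootedHamCycle M₂ n)
            where
  module H₁ = RootedHamCycle H₁
  module H₂ = RootedHamCycle H₂

  d₁ d₂ : ℕ
  d₁ = d M₁
  d₂ = d M₂

  open Blocks d₁ d₂

  σ₁ α₁ : Fin d₁ → Fin d₁
  σ₁ = σ M₁ ⟨$⟩ʳ_
  α₁ = α M₁ ⟨$⟩ʳ_

  σ₂ α₂ : Fin d₂ → Fin d₂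
  σ₂ = σ M₂ ⟨$⟩ʳ_
  α₂ = α M₂ ⟨$⟩ʳ_

  ∈C∪n-cases : ∀ {v} → v ∈ C ∪ ⁅ n ⁆ → v ∈ C ⊎ v ≡ n
  ∈C∪n-cases v∈ = Sum.map₂ (x∈⁅y⁆⇒x≡y n) (x∈p∪q⁻ C ⁅ n ⁆ v∈)

  a b : Fin N
  a = H₁.h H₁.last
  b = H₂.h (suc zero)

  a≢n : a ≢ n
  a≢n eq with H₁.h-inj _ _ (trans eq (sym H₁.root))
  ... | ()

  a∉C : a ∉ C
  a∉C = x∈∁p⇒x∉p (H₁.h∈S H₁.last)

  H₂-suc∈C : ∀ j → H₂.h (suc j) ∈ C
  H₂-suc∈C j with ∈C∪n-cases (H₂.h∈S (suc j))
  ... | inj₁ ∈C = ∈C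
  ... | inj₂ ≡n = ⊥-elim (H₂.h-suc≢root j ≡n)

  p : Fin d₁
  p = H₁.e H₁.last

  q : Fin d₂
  q = H₂.e zero

  tail-p : tail M₁ p ≡ a
  tail-p = H₁.e-tail H₁.last

  head-p : tail M₁ (α₁ p) ≡ n
  head-p = trans (H₁.e-head H₁.last) (trans (cong H₁.h H₁.next-last) H₁.root)

  tail-q : tail M₂ q ≡ n
  tail-q = trans (H₂.e-tail zero) H₂.root

  head-q : tail M₂ (α₂ q) ≡ b
  head-q = trans (H₂.e-head zero) (cong H₂.h H₂.next-zero)

  newTail : Fin 2 → Fin N
  newTail zero    = a
  newTail (suc _) = b

  tail₀ : Dart → Fin N
  tail₀ = caseDart (tail M₁) (tail M₂) newTail

  tail₀-inl : ∀ x → tail₀ (inl x) ≡ tail M₁ x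
  tail₀-inl = caseDart-inl (tail M₁) (tail M₂) newTail

  tail₀-inr : ∀ y → tail₀ (inr y) ≡ tail M₂ y
  tail₀-inr = caseDart-inr (tail M₁) (tail M₂) newTail

  tail₀-new : ∀ s → tail₀ (new s) ≡ newTail s
  tail₀-new = caseDart-new (tail M₁) (tail M₂) newTail

  σ₀ α₀ : Permutation′ ((d₁ + d₂) + 2)
  σ₀ = (σ M₁ ⊕ₚ σ M₂) ⊕ₚ Perm.id
  α₀ = (α M₁ ⊕ₚ α M₂) ⊕ₚ Perm.reverse

  σ₀f α₀f : Dart → Dart
  σ₀f = σ₀ ⟨$⟩ʳ_
  α₀f = α₀ ⟨$⟩ʳ_

  α₀-inl : ∀ x → α₀f (inl x) ≡ inl (α₁ x)
  α₀-inl = blockwise-inl α₁ α₂ Fin.opposite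

  α₀-inr : ∀ y → α₀f (inr y) ≡ inr (α₂ y)
  α₀-inr = blockwise-inr α₁ α₂ Fin.opposite

  α₀-new : ∀ s → α₀f (new s) ≡ new (Fin.opposite s)
  α₀-new = blockwise-new α₁ α₂ Fin.opposite

  σ₀-inl : ∀ x → σ₀f (inl x) ≡ inl (σ₁ x)
  σ₀-inl = blockwise-inl σ₁ σ₂ (λ s → s)

  σ₀-inr : ∀ y → σ₀f (inr y) ≡ inr (σ₂ y)
  σ₀-inr = blockwise-inr σ₁ σ₂ (λ s → s)

  σ₀-new : ∀ s → σ₀f (new s) ≡ new s
  σ₀-new = blockwise-new σ₁ σ₂ (λ s → s)

  α₀-invol : ∀ z → α₀f (α₀f z) ≡ z
  α₀-invol z with view z
  ... | inl-view x = trans (cong α₀f (α₀-inl x)) (trans (α₀-inl _) (cong inl (α-invol M₁ x)))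
  ... | inr-view y = trans (cong α₀f (α₀-inr y)) (trans (α₀-inr _) (cong inr (α-invol M₂ y)))
  ... | new-view s = trans (cong α₀f (α₀-new s)) (trans (α₀-new _) (cong new (Finₚ.opposite-involutive s)))

  α₀-free : ∀ z → α₀f z ≢ z
  α₀-free z with view z
  ... | inl-view x = λ eq → α-free M₁ x (inl-injective (trans (sym (α₀-inl x)) eq))
  ... | inr-view y = λ eq → α-free M₂ y (inr-injective (trans (sym (α₀-inr y)) eq))
  ... | new-view zero    = λ eq → new0≢new1 (sym (trans (sym (α₀-new zero)) eq))
  ... | new-view (suc zero) = λ eq → new0≢new1 (trans (sym (α₀-new (suc zero))) eq)

  tail₀-σ₀ : ∀ z → tail₀ (σ₀f z) ≡ tail₀ z
  tail₀-σ₀ z with view z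
  ... | inl-view x = trans (cong tail₀ (σ₀-inl x)) (trans (tail₀-inl _) (trans (σ-tail M₁ x) (sym (tail₀-inl x))))
  ... | inr-view y = trans (cong tail₀ (σ₀-inr y)) (trans (tail₀-inr _) (trans (σ-tail M₂ y) (sym (tail₀-inr y))))
  ... | new-view s = cong tail₀ (σ₀-new s)

  n₁ n₂ a′ b′ t t′ : Dart
  n₁ = inl (α₁ p)
  n₂ = inr (σ M₂ ⟨$⟩ˡ q)
  a′ = inl (σ M₁ ⟨$⟩ˡ p)
  b′ = inr (α₂ q)
  t  = new zero
  t′ = new (suc zero)

  tail-n₁ : tail₀ n₁ ≡ n
  tail-n₁ = trans (tail₀-inl _) head-p

  tail-n₂ : tail₀ n₂ ≡ n
  tail-n₂ = trans (tail₀-inr _) (trans (tail-σ⁻¹ M₂ q) tail-q)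

  tail-a′ : tail₀ a′ ≡ a
  tail-a′ = trans (tail₀-inl _) (trans (tail-σ⁻¹ M₁ p) tail-p)

  tail-b′ : tail₀ b′ ≡ b
  tail-b′ = trans (tail₀-inr _) head-q

  σA σB σC : Permutation′ ((d₁ + d₂) + 2)
  σA = transpose n₁ n₂ ∘ₚ σ₀
  σB = transpose t a′ ∘ₚ σA
  σC = transpose t′ b′ ∘ₚ σB

  σAf σBf σCf : Dart → Dart
  σAf = σA ⟨$⟩ʳ_
  σBf = σB ⟨$⟩ʳ_
  σCf = σC ⟨$⟩ʳ_

  tail₀-σC : ∀ z → tail₀ (σCf z) ≡ tail₀ z
  tail₀-σC z = trans (tail₀-σ₀ _) (trans (transpose-preserves tail₀ (trans tail-n₁ (sym tail-n₂)) _)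
    (trans (transpose-preserves tail₀ (trans (tail₀-new zero) (sym tail-a′)) _)
           (transpose-preserves tail₀ (trans (tail₀-new (suc zero)) (sym tail-b′)) z)))

  σA-t : σAf t ≡ t
  σA-t = trans (cong σ₀f (transpose-elsewhere (inl≢new ∘ sym) (inr≢new ∘ sym))) (σ₀-new zero)

  σB-t′ : σBf t′ ≡ t′
  σB-t′ = trans (cong σAf (transpose-elsewhere (new0≢new1 ∘ sym) (inl≢new ∘ sym)))
                (trans (cong σ₀f (transpose-elsewhere (inl≢new ∘ sym) (inr≢new ∘ sym))) (σ₀-new (suc zero)))

  module MA = Merge (perm-injective σ₀) (perm-injective σA) (transposed σ₀f inl≢inr)
                    (λ n₁↝n₂ → inl≢inr (sym (proj₂ (↝-inl⁻ σ₁ σ₂ (λ s → s) n₁↝n₂))))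
  module MB = Merge (perm-injective σA) (perm-injective σB) (transposed σAf (inl≢new ∘ sym))
                    (λ t↝a′ → inl≢new (sym (↝-fixed σA-t t↝a′)))
  module MC = Merge (perm-injective σB) (perm-injective σC) (transposed σBf (inr≢new ∘ sym))
                    (λ t′↝b′ → inr≢new (sym (↝-fixed σB-t′ t′↝b′)))

  ↝σ₀⇒↝σC : ∀ {x y} → x ↝⟨ σ₀f ⟩ y → x ↝⟨ σCf ⟩ y
  ↝σ₀⇒↝σC = MC.↝-preserved ∘ MB.↝-preserved ∘ MA.↝-preserved

  ↝σ₁⇒↝σC : ∀ {x y} → x ↝⟨ σ₁ ⟩ y → inl x ↝⟨ σCf ⟩ inl y
  ↝σ₁⇒↝σC = ↝σ₀⇒↝σC ∘ ↝-inl σ₁ σ₂ (λ s → s)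

  ↝σ₂⇒↝σC : ∀ {x y} → x ↝⟨ σ₂ ⟩ y → inr x ↝⟨ σCf ⟩ inr y
  ↝σ₂⇒↝σC = ↝σ₀⇒↝σC ∘ ↝-inr σ₁ σ₂ (λ s → s)

  dartAt₀ : Fin N → Dart
  dartAt₀ v with v ∈? C
  ... | yes _ = inr (H₂.dartAt v)
  ... | no _  = inl (H₁.dartAt v)

  inl-reaches-dartAt₀ : ∀ {x v} → tail M₁ x ≡ v → inl x ↝⟨ σCf ⟩ dartAt₀ v
  inl-reaches-dartAt₀ {x} {v} refl with v ∈? C
  ... | yes v∈C = ⊥-elim (x∈∁p⇒x∉p (tail∈S M₁ x) v∈C)
  ... | no _    = ↝σ₁⇒↝σC (σ-cycle M₁ x _ (sym (H₁.tail-dartAt (tail∈S M₁ x))))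

  inr-reaches-dartAt₀ : ∀ {y v} → tail M₂ y ≡ v → v ∈ C → inr y ↝⟨ σCf ⟩ dartAt₀ v
  inr-reaches-dartAt₀ {y} {v} refl v∈C with v ∈? C
  ... | yes _    = ↝σ₂⇒↝σC (σ-cycle M₂ y _ (sym (H₂.tail-dartAt (tail∈S M₂ y))))
  ... | no v∉C   = ⊥-elim (v∉C v∈C)

  -- The rotation at n now runs through the darts of both maps: n₂ ↝ n₁ via the first transposition.
  σC-reaches-dartAt₀ : ∀ z → z ↝⟨ σCf ⟩ dartAt₀ (tail₀ z)
  σC-reaches-dartAt₀ z with view z
  ... | inl-view x = inl-reaches-dartAt₀ (sym (tail₀-inl x))
  ... | inr-view y with ∈C∪n-cases (tail∈S M₂ y)
  ...   | inj₁ ∈C = inr-reaches-dartAt₀ (sym (tail₀-inr y)) (subst (_∈ C) (sym (tail₀-inr y)) ∈C)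
  ...   | inj₂ ≡n =
    ↝-trans (↝σ₂⇒↝σC (σ-cycle M₂ y _ (trans ≡n (sym (trans (tail-σ⁻¹ M₂ q) tail-q)))))
   (↝-trans (MC.↝-preserved (MB.↝-preserved (↝-sym (perm-injective σA) MA.p↝q)))
            (inl-reaches-dartAt₀ (trans head-p (sym (trans (tail₀-inr y) ≡n)))))
  σC-reaches-dartAt₀ z | new-view zero =
    ↝-trans (MC.↝-preserved MB.p↝q) (inl-reaches-dartAt₀ (trans (tail-σ⁻¹ M₁ p) (trans tail-p (sym (tail₀-new zero)))))
  σC-reaches-dartAt₀ z | new-view (suc zero) =
    ↝-trans MC.p↝q (inr-reaches-dartAt₀ (trans head-q (sym (tail₀-new (suc zero))))
                                        (subst (_∈ C) (sym (tail₀-new (suc zero))) (H₂-suc∈C zero)))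

  σC-cycle : ∀ z y → tail₀ z ≡ tail₀ y → z ↝⟨ σCf ⟩ y
  σC-cycle z y eq = ↝-trans (σC-reaches-dartAt₀ z)
    (↝-sym (perm-injective σC) (subst (λ v → y ↝⟨ σCf ⟩ dartAt₀ v) (sym eq) (σC-reaches-dartAt₀ y)))

  M : Map ⊤
  M = record
    { d = (d₁ + d₂) + 2 ; tail = tail₀ ; tail∈S = λ _ → ∈⊤ ; σ = σC ; α = α₀
    ; α-invol = α₀-invol ; α-free = α₀-free ; σ-tail = tail₀-σC ; σ-cycle = σC-cycle }

  same-vertex : ∀ {z y} → tail₀ z ≡ tail₀ y → Reach M z y
  same-vertex eq = ↝σ⇒Reach M (σC-cycle _ _ eq)

  reach-inl : ∀ {x y} → Reach M₁ x y → Reach M (inl x) (inl y)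
  reach-inl here = here
  reach-inl {x} (stepσ r) =
    Reach-trans M (same-vertex (trans (tail₀-inl x) (trans (sym (σ-tail M₁ x)) (sym (tail₀-inl _))))) (reach-inl r)
  reach-inl {x} {y} (stepα r) = stepα (subst (λ z → Reach M z (inl y)) (sym (α₀-inl x)) (reach-inl r))

  reach-inr : ∀ {x y} → Reach M₂ x y → Reach M (inr x) (inr y)
  reach-inr here = here
  reach-inr {x} (stepσ r) =
    Reach-trans M (same-vertex (trans (tail₀-inr x) (trans (sym (σ-tail M₂ x)) (sym (tail₀-inr _))))) (reach-inr r)
  reach-inr {x} {y} (stepα r) = stepα (subst (λ z → Reach M z (inr y)) (sym (α₀-inr x)) (reach-inr r))

  n₂⇝n₁ : Reach M n₂ n₁
  n₂⇝n₁ = same-vertex (trans tail-n₂ (sym tail-n₁))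

  n₁⇝n₂ : Reach M n₁ n₂
  n₁⇝n₂ = same-vertex (trans tail-n₁ (sym tail-n₂))

  t≈a′ : tail₀ t ≡ tail₀ a′
  t≈a′ = trans (tail₀-new zero) (sym tail-a′)

  t′≈b′ : tail₀ t′ ≡ tail₀ b′
  t′≈b′ = trans (tail₀-new (suc zero)) (sym tail-b′)

  to-n₁ : ∀ z → Reach M z n₁
  to-n₁ z with view z
  ... | inl-view x = reach-inl (proj₁ planar₁ x (α₁ p))
  ... | inr-view y = Reach-trans M (reach-inr (proj₁ planar₂ y _)) n₂⇝n₁
  ... | new-view zero       = Reach-trans M (same-vertex t≈a′) (reach-inl (proj₁ planar₁ _ _))
  ... | new-view (suc zero) =
    Reach-trans M (same-vertex t′≈b′) (Reach-trans M (reach-inr (proj₁ planar₂ _ _)) n₂⇝n₁)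

  from-n₁ : ∀ z → Reach M n₁ z
  from-n₁ z with view z
  ... | inl-view x = reach-inl (proj₁ planar₁ (α₁ p) x)
  ... | inr-view y = Reach-trans M n₁⇝n₂ (reach-inr (proj₁ planar₂ _ y))
  ... | new-view zero       = Reach-trans M (reach-inl (proj₁ planar₁ _ _)) (same-vertex (sym t≈a′))
  ... | new-view (suc zero) =
    Reach-trans M n₁⇝n₂ (Reach-trans M (reach-inr (proj₁ planar₂ _ _)) (same-vertex (sym t′≈b′)))

  connected : Connected M
  connected z y = Reach-trans M (to-n₁ z) (from-n₁ y)

  φ₁ : Fin d₁ → Fin d₁
  φ₁ = φ M₁

  φ₂ : Fin d₂ → Fin d₂
  φ₂ = φ M₂

  φ₀ φA φB : Dart → Dart
  φ₀ = σ₀f ∘ α₀f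
  φA = σAf ∘ α₀f
  φB = σBf ∘ α₀f

  φ-injective : ∀ (π : Permutation′ ((d₁ + d₂) + 2)) → Injective _≡_ _≡_ ((π ⟨$⟩ʳ_) ∘ α₀f)
  φ-injective π = perm-injective α₀ ∘ perm-injective π

  φ₀-blockwise : ∀ z → φ₀ z ≡ blockwise φ₁ φ₂ Fin.opposite z
  φ₀-blockwise z with view z
  ... | inl-view x = trans (cong σ₀f (α₀-inl x)) (trans (σ₀-inl _) (sym (blockwise-inl φ₁ φ₂ Fin.opposite x)))
  ... | inr-view y = trans (cong σ₀f (α₀-inr y)) (trans (σ₀-inr _) (sym (blockwise-inr φ₁ φ₂ Fin.opposite y)))
  ... | new-view s = trans (cong σ₀f (α₀-new s)) (trans (σ₀-new _) (sym (blockwise-new φ₁ φ₂ Fin.opposite s)))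

  faces₀ : orbitCount φ₀ ≡ suc (numFaces M₁ + numFaces M₂)
  faces₀ = begin
    orbitCount φ₀                                       ≡⟨ orbitCount-cong φ₀-blockwise ⟩
    orbitCount ((φ₁ ⊕ φ₂) ⊕ Fin.opposite)               ≡⟨ orbitCount-⊕ (φ₁ ⊕ φ₂) Fin.opposite φ₁⊕φ₂-inj opposite-inj ⟩
    orbitCount (φ₁ ⊕ φ₂) + 1                            ≡⟨ cong (_+ 1) (orbitCount-⊕ φ₁ φ₂ φ₁-inj φ₂-inj) ⟩
    (numFaces M₁ + numFaces M₂) + 1                     ≡⟨ +-comm _ 1 ⟩
    suc (numFaces M₁ + numFaces M₂)                     ∎
    where
    open ≡-Reasoning
    φ₁-inj : Injective _≡_ _≡_ φ₁
    φ₁-inj = perm-injective (α M₁) ∘ perm-injective (σ M₁)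
    φ₂-inj : Injective _≡_ _≡_ φ₂
    φ₂-inj = perm-injective (α M₂) ∘ perm-injective (σ M₂)
    φ₁⊕φ₂-inj : Injective _≡_ _≡_ (φ₁ ⊕ φ₂)
    φ₁⊕φ₂-inj = ⊕-injective φ₁ φ₂ φ₁-inj φ₂-inj
    opposite-inj : Injective _≡_ _≡_ (Fin.opposite {2})
    opposite-inj = perm-injective Perm.reverse

  inl-stays : ∀ {x z} → inl x ↝⟨ φ₀ ⟩ z → ∃[ y ] z ≡ inl y
  inl-stays = ↝-inl⁻ φ₁ φ₂ Fin.opposite ∘ ↝-cong φ₀-blockwise

  inr-stays : ∀ {x z} → inr x ↝⟨ φ₀ ⟩ z → ∃[ y ] z ≡ inr y
  inr-stays = ↝-inr⁻ φ₁ φ₂ Fin.opposite ∘ ↝-cong φ₀-blockwise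

  new-stays : ∀ {s z} → new s ↝⟨ φ₀ ⟩ z → ∃[ s′ ] z ≡ new s′
  new-stays = ↝-new⁻ φ₁ φ₂ Fin.opposite ∘ ↝-cong φ₀-blockwise

  αn₁≁αn₂ : ¬ α₀f n₁ ↝⟨ φ₀ ⟩ α₀f n₂
  αn₁≁αn₂ r with inl-stays (subst (_↝⟨ φ₀ ⟩ α₀f n₂) (α₀-inl _) r)
  ... | _ , eq = inl≢inr (sym (trans (sym (α₀-inr _)) eq))

  module FA = Merge (φ-injective σ₀) (φ-injective σA) (transposed-∘ (transposed σ₀f inl≢inr) α₀f α₀-invol)
                    αn₁≁αn₂

  αt-off-merged : ¬ FA.OnMerged (α₀f t)
  αt-off-merged (inj₁ r) = inl≢new (sym (proj₂ (inl-stays (subst₂ (_↝⟨ φ₀ ⟩_) (α₀-inl _) (α₀-new zero) r))))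
  αt-off-merged (inj₂ r) = inr≢new (sym (proj₂ (inr-stays (subst₂ (_↝⟨ φ₀ ⟩_) (α₀-inr _) (α₀-new zero) r))))

  αt≁αa′ : ¬ α₀f t ↝⟨ φA ⟩ α₀f a′
  αt≁αa′ r with new-stays (subst (_↝⟨ φ₀ ⟩ α₀f a′) (α₀-new zero) (FA.↝-reflected αt-off-merged r))
  ... | _ , eq = inl≢new (trans (sym (α₀-inl _)) eq)

  module FB = Merge (φ-injective σA) (φ-injective σB) (transposed-∘ (transposed σAf (inl≢new ∘ sym)) α₀f α₀-invol)
                    αt≁αa′

  -- After the first two steps t = α t′ and α b′ lie on one face: φA t′ = t, and α a′ ↦ inl p ↦ inr q = α b′.
  αt′↝αb′ : α₀f t′ ↝⟨ φB ⟩ α₀f b′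
  αt′↝αb′ = FB.onMerged-connected (inj₁ (1 , trans (cong σAf (α₀-invol t)) (trans σA-t (sym (α₀-new (suc zero))))))
                                   (inj₂ (2 , trans (cong φA αa′↦p) p↦αb′))
    where
    αa′↦p : φA (α₀f a′) ≡ inl p
    αa′↦p = trans (cong σAf (α₀-invol a′))
              (trans (cong σ₀f (transpose-elsewhere a′≢n₁ inl≢inr)) (trans (σ₀-inl _) (cong inl (inverseʳ (σ M₁)))))
      where
      a′≢n₁ : a′ ≢ n₁
      a′≢n₁ eq = a≢n (trans (sym tail-a′) (trans (cong tail₀ eq) tail-n₁))
    p↦αb′ : φA (inl p) ≡ α₀f b′
    p↦αb′ = trans (cong σAf (α₀-inl p)) (trans (cong σ₀f (transpose-at-p {p = n₁} {n₂}))
              (trans (σ₀-inr _) (trans (cong inr (inverseʳ (σ M₂))) (sym (trans (α₀-inr _) (cong inr (α-invol M₂ q)))))))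

  faces : numFaces M ≡ numFaces M₁ + numFaces M₂
  faces = suc-injective (begin
    suc (orbitCount (φ M))     ≡⟨ cong suc (orbitCount-split (φ-injective σB) transposedC αt′↝αb′ (φ-injective σC)) ⟩
    suc (suc (orbitCount φB))  ≡⟨ cong suc FB.orbitCount-merge ⟨
    suc (orbitCount φA)        ≡⟨ FA.orbitCount-merge ⟨
    orbitCount φ₀              ≡⟨ faces₀ ⟩
    suc (numFaces M₁ + numFaces M₂) ∎)
    where
    open ≡-Reasoning
    transposedC : Transposed φB (σCf ∘ α₀f) (α₀f t′) (α₀f b′)
    transposedC = transposed-∘ (transposed σBf (inr≢new ∘ sym)) α₀f α₀-invol

  euler : numVertices M + numFaces M ≡ numEdges M + 2
  euler with even-darts (α M₁) (α-invol M₁) (α-free M₁) | even-darts (α M₂) (α-invol M₂) (α-free M₂)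
  ... | c₁ , d₁≡c₁+c₁ | c₂ , d₂≡c₂+c₂ = begin
    ∣ ⊤ {N} ∣ + numFaces M                              ≡⟨ cong₂ _+_ (trans (∣⊤∣≡n N) (sym (∣∁p∣+∣p∣ C))) faces ⟩
    (∣ ∁ C ∣ + ∣ C ∣) + (numFaces M₁ + numFaces M₂)
      ≡⟨ euler-glued {∣ ∁ C ∣} {∣ C ∣} {numFaces M₁} {numFaces M₂} euler₁ euler₂ ⟩
    (c₁ + c₂ + 1) + 2                                   ≡⟨ cong (_+ 2) (half-double (c₁ + c₂ + 1)) ⟨
    ((c₁ + c₂ + 1) + (c₁ + c₂ + 1)) / 2 + 2             ≡⟨ cong (λ D → D / 2 + 2) darts ⟨
    ((d₁ + d₂) + 2) / 2 + 2                             ∎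
    where
    open ≡-Reasoning
    open +-*-Solver
    edges : ∀ {d′ c} → d′ ≡ c + c → d′ / 2 ≡ c
    edges {c = c} refl = half-double c
    euler₁ : ∣ ∁ C ∣ + numFaces M₁ ≡ c₁ + 2
    euler₁ = trans (proj₂ planar₁) (cong (_+ 2) (edges d₁≡c₁+c₁))
    euler₂ : suc ∣ C ∣ + numFaces M₂ ≡ c₂ + 2
    euler₂ = trans (cong (_+ numFaces M₂) (sym (∣p∪⁅x⁆∣ C n∉C)))
                   (trans (proj₂ planar₂) (cong (_+ 2) (edges d₂≡c₂+c₂)))
    darts : (d₁ + d₂) + 2 ≡ (c₁ + c₂ + 1) + (c₁ + c₂ + 1)
    darts = trans (cong₂ (λ x y → (x + y) + 2) d₁≡c₁+c₁ d₂≡c₂+c₂)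
                  (solve 2 (λ x y → (x :+ x :+ (y :+ y)) :+ con 2 := (x :+ y :+ con 1) :+ (x :+ y :+ con 1)) refl c₁ c₂)

  edge₁ : ∀ {u v} → u ∈ ∁ C → v ∈ ∁ C → Adj G u v → ∃[ z ] tail₀ z ≡ u × tail₀ (α₀f z) ≡ v
  edge₁ {u} {v} u∈ v∈ adj with contains₁ u v u∈ v∈ adj
  ... | z , tz , hz = inl z , trans (tail₀-inl z) tz , trans (cong tail₀ (α₀-inl z)) (trans (tail₀-inl _) hz)

  edge₂ : ∀ {u v} → u ∈ C ∪ ⁅ n ⁆ → v ∈ C ∪ ⁅ n ⁆ → Adj G u v → ∃[ z ] tail₀ z ≡ u × tail₀ (α₀f z) ≡ v
  edge₂ {u} {v} u∈ v∈ adj with contains₂ u v u∈ v∈ adj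
  ... | z , tz , hz = inr z , trans (tail₀-inr z) tz , trans (cong tail₀ (α₀-inr z)) (trans (tail₀-inr _) hz)

  is-n : ∀ {v} → v ≡ n → v ∈ C ∪ ⁅ n ⁆
  is-n refl = x∈p∪⁅x⁆ C n

  contains : ContainsEdges G M
  contains u v _ _ adj with u ∈? C | v ∈? C
  ... | no u∉C  | no v∉C  = edge₁ (x∉p⇒x∈∁p u∉C) (x∉p⇒x∈∁p v∉C) adj
  ... | yes u∈C | yes v∈C = edge₂ (x∈p∪q⁺ (inj₁ u∈C)) (x∈p∪q⁺ (inj₁ v∈C)) adj
  ... | yes u∈C | no v∉C  = edge₂ (x∈p∪q⁺ (inj₁ u∈C)) (is-n (separates v∉C u∈C (Graph.sym G adj))) adj
  ... | no u∉C  | yes v∈C = edge₂ (is-n (separates u∉C v∈C adj)) (x∈p∪q⁺ (inj₁ v∈C)) adj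

  K₁ K : ℕ
  K₁ = 2 + H₁.len
  K  = K₁ + suc H₂.len

  hG : Fin K → Fin N
  hG = [ H₁.h , H₂.h ∘ suc ]′ ∘ splitAt K₁

  hG-↑ˡ : ∀ i → hG (i ↑ˡ suc H₂.len) ≡ H₁.h i
  hG-↑ˡ i rewrite Finₚ.splitAt-↑ˡ K₁ i (suc H₂.len) = refl

  hG-↑ʳ : ∀ j → hG (K₁ ↑ʳ j) ≡ H₂.h (suc j)
  hG-↑ʳ j rewrite Finₚ.splitAt-↑ʳ K₁ (suc H₂.len) j = refl

  e₁′ : Fin K₁ → Dart
  e₁′ i with i Finₚ.≟ H₁.last
  ... | yes _ = t
  ... | no _  = inl (H₁.e i)

  e₁′-last : e₁′ H₁.last ≡ t
  e₁′-last with H₁.last Finₚ.≟ H₁.last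
  ... | yes _  = refl
  ... | no last≢last = ⊥-elim (last≢last refl)

  e₁′-other : ∀ {i} → i ≢ H₁.last → e₁′ i ≡ inl (H₁.e i)
  e₁′-other {i} i≢ with i Finₚ.≟ H₁.last
  ... | yes i≡ = ⊥-elim (i≢ i≡)
  ... | no _   = refl

  e₁′-view : ∀ i → (i ≡ H₁.last × e₁′ i ≡ t) ⊎ (i ≢ H₁.last × e₁′ i ≡ inl (H₁.e i))
  e₁′-view i = view′ (i Finₚ.≟ H₁.last)
    where
    view′ : Dec (i ≡ H₁.last) → (i ≡ H₁.last × e₁′ i ≡ t) ⊎ (i ≢ H₁.last × e₁′ i ≡ inl (H₁.e i))
    view′ (yes i≡) = inj₁ (i≡ , trans (cong e₁′ i≡) e₁′-last)
    view′ (no i≢)  = inj₂ (i≢ , e₁′-other i≢)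

  eG : Fin K → Dart
  eG = [ e₁′ , inr ∘ H₂.e ∘ suc ]′ ∘ splitAt K₁

  eG-↑ˡ : ∀ i → eG (i ↑ˡ suc H₂.len) ≡ e₁′ i
  eG-↑ˡ i rewrite Finₚ.splitAt-↑ˡ K₁ i (suc H₂.len) = refl

  eG-↑ʳ : ∀ j → eG (K₁ ↑ʳ j) ≡ inr (H₂.e (suc j))
  eG-↑ʳ j rewrite Finₚ.splitAt-↑ʳ K₁ (suc H₂.len) j = refl

  block-α₀ : ∀ z → block (α₀f z) ≡ block z
  block-α₀ z with view z
  ... | inl-view x = trans (cong block (α₀-inl x)) (trans (caseDart-inl _ _ _ _) (sym (caseDart-inl _ _ _ _)))
  ... | inr-view y = trans (cong block (α₀-inr y)) (trans (caseDart-inr _ _ _ _) (sym (caseDart-inr _ _ _ _)))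
  ... | new-view s = trans (cong block (α₀-new s)) (trans (caseDart-new _ _ _ _) (sym (caseDart-new _ _ _ _)))

  apart : ∀ {z y} → block z ≢ block y → (z ≢ y) × (z ≢ α₀f y)
  apart blocks≢ = (λ eq → blocks≢ (cong block eq)) , (λ eq → blocks≢ (trans (cong block eq) (block-α₀ _)))

  data EdgeKind (i : Fin K) : Set where
    new-edge : i ≡ H₁.last ↑ˡ suc H₂.len → eG i ≡ t → EdgeKind i
    cycle₁-edge    : ∀ i′ → i ≡ i′ ↑ˡ suc H₂.len → i′ ≢ H₁.last → eG i ≡ inl (H₁.e i′) → EdgeKind i
    cycle₂-edge    : ∀ j → i ≡ K₁ ↑ʳ j → eG i ≡ inr (H₂.e (suc j)) → EdgeKind i

  edgeKind : ∀ i → EdgeKind i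
  edgeKind i with splitView K₁ (suc H₂.len) i
  ... | right j = cycle₂-edge j refl (eG-↑ʳ j)
  ... | left i′ with e₁′-view i′
  ...   | inj₁ (refl , e≡) = new-edge refl (trans (eG-↑ˡ H₁.last) e≡)
  ...   | inj₂ (i′≢last , e≡) = cycle₁-edge i′ refl i′≢last (trans (eG-↑ˡ i′) e≡)

  tag : ∀ {i} → EdgeKind i → Fin 3
  tag (new-edge _ _)    = suc (suc zero)
  tag (cycle₁-edge _ _ _ _)   = zero
  tag (cycle₂-edge _ _ _)     = suc zero

  block-eG : ∀ {i} (κ : EdgeKind i) → block (eG i) ≡ tag κ
  block-eG (new-edge _ eq)   = trans (cong block eq) (caseDart-new _ _ _ _)
  block-eG (cycle₁-edge _ _ _ eq)  = trans (cong block eq) (caseDart-inl _ _ _ _)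
  block-eG (cycle₂-edge _ _ eq)    = trans (cong block eq) (caseDart-inr _ _ _ _)

  eG-dist : ∀ i j → i ≢ j → (eG i ≢ eG j) × (eG i ≢ α₀f (eG j))
  eG-dist i j i≢j = by-kind (edgeKind i) (edgeKind j)
    where
    different : (κ : EdgeKind i) (λ′ : EdgeKind j) → tag κ ≢ tag λ′ → (eG i ≢ eG j) × (eG i ≢ α₀f (eG j))
    different κ λ′ tags≢ = apart (λ eq → tags≢ (trans (sym (block-eG κ)) (trans eq (block-eG λ′))))
    by-kind : EdgeKind i → EdgeKind j → (eG i ≢ eG j) × (eG i ≢ α₀f (eG j))
    by-kind (new-edge refl _) (new-edge refl _) = ⊥-elim (i≢j refl)
    by-kind (cycle₁-edge i′ refl _ ei) (cycle₁-edge j′ refl _ ej) =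
      let (≢e , ≢αe) = H₁.e-dist i′ j′ (λ eq → i≢j (cong (_↑ˡ suc H₂.len) eq)) in
      (λ eq → ≢e (inl-injective (trans (sym ei) (trans eq ej)))) ,
      (λ eq → ≢αe (inl-injective (trans (sym ei) (trans eq (trans (cong α₀f ej) (α₀-inl _))))))
    by-kind (cycle₂-edge i′ refl ei) (cycle₂-edge j′ refl ej) =
      let (≢e , ≢αe) = H₂.e-dist (suc i′) (suc j′) (λ eq → i≢j (cong (K₁ ↑ʳ_) (Finₚ.suc-injective eq))) in
      (λ eq → ≢e (inr-injective (trans (sym ei) (trans eq ej)))) ,
      (λ eq → ≢αe (inr-injective (trans (sym ei) (trans eq (trans (cong α₀f ej) (α₀-inr _))))))
    by-kind κ@(new-edge _ _)    λ′@(cycle₁-edge _ _ _ _) = different κ λ′ λ ()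
    by-kind κ@(new-edge _ _)    λ′@(cycle₂-edge _ _ _)   = different κ λ′ λ ()
    by-kind κ@(cycle₁-edge _ _ _ _)   λ′@(new-edge _ _)  = different κ λ′ λ ()
    by-kind κ@(cycle₁-edge _ _ _ _)   λ′@(cycle₂-edge _ _ _)   = different κ λ′ λ ()
    by-kind κ@(cycle₂-edge _ _ _)     λ′@(new-edge _ _)  = different κ λ′ λ ()
    by-kind κ@(cycle₂-edge _ _ _)     λ′@(cycle₁-edge _ _ _ _) = different κ λ′ λ ()

  ≢last⇒< : ∀ {k} {i : Fin (suc k)} → i ≢ Fin.fromℕ k → suc (toℕ i) < suc k
  ≢last⇒< {k} {i} i≢last =
    ≤∧≢⇒< (Finₚ.toℕ<n i) (λ eq → i≢last (Finₚ.toℕ-injective (trans (suc-injective eq) (sym (Finₚ.toℕ-fromℕ k)))))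

  eG-tail : ∀ i → tail₀ (eG i) ≡ hG i
  eG-tail i with edgeKind i
  ... | new-edge refl e≡ = trans (cong tail₀ e≡) (trans (tail₀-new zero) (sym (hG-↑ˡ H₁.last)))
  ... | cycle₁-edge i′ refl _ e≡ =
    trans (cong tail₀ e≡) (trans (tail₀-inl _) (trans (H₁.e-tail i′) (sym (hG-↑ˡ i′))))
  ... | cycle₂-edge j refl e≡ =
    trans (cong tail₀ e≡) (trans (tail₀-inr _) (trans (H₂.e-tail (suc j)) (sym (hG-↑ʳ j))))

  eG-head : ∀ i → tail₀ (α₀f (eG i)) ≡ hG (next i)
  eG-head i with edgeKind i
  ... | new-edge refl e≡ = begin
    tail₀ (α₀f (eG i))                      ≡⟨ cong (tail₀ ∘ α₀f) e≡ ⟩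
    tail₀ (α₀f t)                           ≡⟨ trans (cong tail₀ (α₀-new zero)) (tail₀-new (suc zero)) ⟩
    b                                       ≡⟨ hG-↑ʳ zero ⟨
    hG (K₁ ↑ʳ zero)                         ≡⟨ cong hG (next-↑ˡ-last H₁.last (cong suc (Finₚ.toℕ-fromℕ _))) ⟨
    hG (next (H₁.last ↑ˡ suc H₂.len))       ∎
    where open ≡-Reasoning
  ... | cycle₁-edge i′ refl i′≢last e≡ = begin
    tail₀ (α₀f (eG i))                      ≡⟨ cong (tail₀ ∘ α₀f) e≡ ⟩
    tail₀ (α₀f (inl (H₁.e i′)))             ≡⟨ cong tail₀ (α₀-inl _) ⟩
    tail₀ (inl (α₁ (H₁.e i′)))              ≡⟨ trans (tail₀-inl _) (H₁.e-head i′) ⟩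
    H₁.h (next i′)                          ≡⟨ hG-↑ˡ (next i′) ⟨
    hG (next i′ ↑ˡ suc H₂.len)              ≡⟨ cong hG (next-↑ˡ i′ (≢last⇒< i′≢last)) ⟨
    hG (next (i′ ↑ˡ suc H₂.len))            ∎
    where open ≡-Reasoning
  ... | cycle₂-edge j refl e≡ = begin
    tail₀ (α₀f (eG i))                      ≡⟨ cong (tail₀ ∘ α₀f) e≡ ⟩
    tail₀ (α₀f (inr (H₂.e (suc j))))        ≡⟨ cong tail₀ (α₀-inr _) ⟩
    tail₀ (inr (α₂ (H₂.e (suc j))))         ≡⟨ trans (tail₀-inr _) (H₂.e-head (suc j)) ⟩
    H₂.h (next (suc j))                     ≡⟨ wraps (m≤n⇒m<n∨m≡n (Finₚ.toℕ<n j)) ⟩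
    hG (next (K₁ ↑ʳ j))                     ∎
    where
    open ≡-Reasoning
    wraps : suc (toℕ j) < suc H₂.len ⊎ suc (toℕ j) ≡ suc H₂.len → H₂.h (next (suc j)) ≡ hG (next (K₁ ↑ʳ j))
    wraps (inj₁ j<) =
      trans (cong H₂.h (next-suc j j<)) (sym (trans (cong hG (next-↑ʳ {m = suc H₁.len} j j<)) (hG-↑ʳ _)))
    wraps (inj₂ j≡) =
      trans (cong H₂.h (next-suc-last j j≡)) (trans H₂.root (sym (trans (cong hG (next-↑ʳ-last {m = suc H₁.len} j j≡)) H₁.root)))

  hG-onto : ∀ v → v ∈ ⊤ → ∃[ i ] hG i ≡ v
  hG-onto v _ with v ∈? C
  ... | no v∉C with H₁.h-onto v (x∉p⇒x∈∁p v∉C)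
  ...   | i , eq = i ↑ˡ suc H₂.len , trans (hG-↑ˡ i) eq
  hG-onto v _ | yes v∈C with H₂.h-onto v (x∈p∪q⁺ (inj₁ v∈C))
  ...   | zero  , eq = ⊥-elim (n∉C (subst (_∈ C) (trans (sym eq) H₂.root) v∈C))
  ...   | suc j , eq = K₁ ↑ʳ j , trans (hG-↑ʳ j) eq

  halves-disjoint : ∀ i j → H₁.h i ≢ H₂.h (suc j)
  halves-disjoint i j eq = x∈∁p⇒x∉p (H₁.h∈S i) (subst (_∈ C) (sym eq) (H₂-suc∈C j))

  hG-inj : ∀ i j → hG i ≡ hG j → i ≡ j
  hG-inj i j eq with splitView K₁ (suc H₂.len) i | splitView K₁ (suc H₂.len) j
  ... | left i′  | left j′  = cong (_↑ˡ suc H₂.len) (H₁.h-inj i′ j′ (trans (sym (hG-↑ˡ i′)) (trans eq (hG-↑ˡ j′))))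
  ... | right i′ | right j′ = cong (K₁ ↑ʳ_) (Finₚ.suc-injective (H₂.h-inj _ _ (trans (sym (hG-↑ʳ i′)) (trans eq (hG-↑ʳ j′)))))
  ... | left i′  | right j′ = ⊥-elim (halves-disjoint i′ j′ (trans (sym (hG-↑ˡ i′)) (trans eq (hG-↑ʳ j′))))
  ... | right i′ | left j′  = ⊥-elim (halves-disjoint j′ i′ (trans (sym (hG-↑ˡ j′)) (trans (sym eq) (hG-↑ʳ i′))))

  cycle : HamCycle M
  cycle = record
    { k = K ; h = hG ; h∈S = λ _ → ∈⊤ ; h-onto = hG-onto ; h-inj = hG-inj
    ; e = eG ; e-tail = eG-tail ; e-head = eG-head ; e-dist = eG-dist }

  glued : Subhamiltonian G ⊤
  glued = M , (connected , euler) , contains , cycle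

module _ {N} (G : Graph N) {C : Subset N} {n : Fin N} (n∉C : n ∉ C)
         (separates : ∀ {v c} → v ∉ C → c ∈ C → Adj G v c → v ≡ n) where

  subhamiltonian-join : ∀ {c} → c ∈ C →
    Subhamiltonian G (∁ C) → Subhamiltonian G (C ∪ ⁅ n ⁆) → Subhamiltonian G ⊤
  subhamiltonian-join {c} c∈C (M₁ , planar₁ , contains₁ , H₁) sh₂@(M₂ , planar₂ , contains₂ , H₂)
    with Finₚ.any? (λ v → ¬? (v ∈? C) ×-dec ¬? (v Finₚ.≟ n))
  ... | yes (v , v∉C , v≢n) =
    Glue.glued G C n n∉C separates planar₁ contains₁ (rootAt M₁ H₁ (x∉p⇒x∈∁p n∉C) (x∉p⇒x∈∁p v∉C) v≢n)
                                   planar₂ contains₂ (rootAt M₂ H₂ (x∈p∪⁅x⁆ C n) (x∈p∪q⁺ (inj₁ c∈C)) c≢n)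
    where c≢n : c ≢ n
          c≢n c≡n = n∉C (subst (_∈ C) c≡n c∈C)
  ... | no none = subst (Subhamiltonian G) (⊆-antisym (λ _ → ∈⊤) everything) sh₂
    where
    everything : ⊤ ⊆ C ∪ ⁅ n ⁆
    everything {v} _ with v ∈? C | v Finₚ.≟ n
    ... | yes v∈C | _      = x∈p∪q⁺ (inj₁ v∈C)
    ... | no _   | yes refl = x∈p∪⁅x⁆ C n
    ... | no v∉C | no v≢n   = ⊥-elim (none (v , v∉C , v≢n))

mainTheorem4 : ∀ {N : ℕ} (G : Graph N) (C : Subset N) (n : Fin N) →
    (∀ v → InNbhd G C v ⇔ v ≡ n) →
    Subhamiltonian G ⊤ ⇔ (Subhamiltonian G (∁ C) × Subhamiltonian G (C ∪ ⁅ n ⁆))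
mainTheorem4 G C n N[C]≡n = mk⇔
  (λ sh → subhamiltonian-⊆ G sh (λ _ → ∈⊤) (x∉p⇒x∈∁p n∉C) ,
          subhamiltonian-⊆ G sh (λ _ → ∈⊤) (x∈p∪⁅x⁆ C n))
  (λ (sh₁ , sh₂) → subhamiltonian-join G n∉C separates c∈C sh₁ sh₂)
  where
  n-adjacent : InNbhd G C n
  n-adjacent = Equivalence.from (N[C]≡n n) refl
  n∉C : n ∉ C
  n∉C = proj₁ n-adjacent
  c∈C : proj₁ (proj₂ n-adjacent) ∈ C
  c∈C = proj₁ (proj₂ (proj₂ n-adjacent))
  separates : ∀ {v c} → v ∉ C → c ∈ C → Adj G v c → v ≡ n
  separates v∉C c∈C adj = Equivalence.to (N[C]≡n _) (v∉C , _ , c∈C , adj)
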